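{- Let $\mathbf k\in(\mathbb N\cup\{\infty\})^\ell$ and let $\mathbf I=(\mathbf i_1,\dots,\mathbf i_m)$ be a vector composition. Then \[\nu_{\mathcal Q}^{\mathbf k}(M_{\mathbf I})=\begin{cases}1&\mathbf I=(),\\ 2(-1)^{\mathrm{len}(\mathbf I)+|\mathbf I|}&\text{if }|\mathbf i_m|\text{ is odd and }\Sigma\mathbf I\le\mathbf k,\\ 2(-1)^{\mathrm{len}(\mathbf I)}&\text{if }|\mathbf I|-|\mathbf i_m|\text{ is odd},\ \Sigma\mathbf I-\mathbf i_m\le\mathbf k\text{ and }\Sigma\mathbf I\not\le\mathbf k,\\ 0&\text{otherwise,}\end{cases}\] and $\nu_{\mathcal Q}^{\mathbf k}(F_{\mathbf I})=1$ if $\mathbf I=()$; $\nu_{\mathcal Q}^{\mathbf k}(F_{\mathbf I})=2$ if $\mathbf I=(\mathbf E,\mathbf i)$ where $\mathbf E$ is a (possibly empty) sequence of coordinate vectors $\mathbf e_j$ and $\mathbf i$ is a single column, and one of the following holds: (1) $\Sigma\mathbf I\le\mathbf k$; (2) $|\mathbf E|$ is odd and $\Sigma\mathbf E\le\mathbf k$; (3) $|\mathbf E|$ is even, $|\mathbf i|>1$ and $\Sigma\mathbf E+\mathbf e\le\mathbf k$, where $\mathbf e$ is the unique coordinate vector with $\mathbf i\preccurlyeq(\mathbf e,\mathbf i-\mathbf e)$ (namely $\mathbf e=\mathbf e_c$ with $c$ the smallest index such that the $c$-th entry of $\mathbf i$ is nonzero); and $\nu_{\mathcal Q}^{\mathbf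 k}(F_{\mathbf I})=0$ otherwise.
   Context: Fix $\ell\ge1$; $\mathbf e_0,\dots,\mathbf e_{\ell-1}$ are the coordinate vectors of $\mathbb N^\ell$; $|\mathbf n|=\sum n_i$, coordinatewise order on $(\mathbb N\cup\{\infty\})^\ell$. Vector composition: sequence $\mathbf I=(\mathbf i_1,\dots,\mathbf i_m)$ of nonzero elements of $\mathbb N^\ell$; $\mathrm{len}(\mathbf I)=m$, $\Sigma\mathbf I=\sum\mathbf i_r$, $|\mathbf I|=|\Sigma\mathbf I|$; $\Sigma()=\mathbf 0$. $\mathbf I\preccurlyeq\mathbf J$ means $\mathbf J=\mathbf J_1\cdots\mathbf J_m$ with each $\mathbf J_k$ a vector composition whose columns sum to $\mathbf i_k$ and such that, within each $\mathbf J_k$, every index in the support of a column is $\le$ every index in the support of every later column of $\mathbf J_k$. $\mathrm{QSym}^{(\ell)}$ is the $\mathbb Q$-span of $M_{\mathbf I}=\sum_{j_1<\dots<j_m}\mathbf x_{j_1}^{\mathbf i_1}\cdots\mathbf x_{j_m}^{\mathbf i_m}$ ($M_{()}=1$) in commuting variables $x_j^{(i)}$ ($\mathbf x_j^{\mathbf n}=\prod_i(x_j^{(i)})^{n_i}$), a graded connected Hopf algebra with product of power series, deconcatenation coproduct and antipode $\mathsf S_{\mathcal Q}$; $F_{\mathbf I}=\sum_{\mathbf I\preccurlyeq\mathbf J}M_{\mathbf J}$ (with $F_{()}=1$). $\zeta_{\mathcal Q}(M_{\mathbf I})=1$ if $\mathrm{len}(\mathbf I)\le1$, else $0$; $\bar\zeta_{\mathcal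 Q}(h)=(-1)^{|\mathbf n|}\zeta_{\mathcal Q}(h)$ on degree $\mathbf n$. Define $\zeta_{\mathcal Q}^{\mathbf k}$ to agree with $\bar\zeta_{\mathcal Q}$ on degrees $\mathbf n\le\mathbf k$ and with $\zeta_{\mathcal Q}$ on other degrees, and $\nu_{\mathcal Q}^{\mathbf k}=(\zeta_{\mathcal Q}^{\mathbf k}\circ\mathsf S_{\mathcal Q})\,\zeta_{\mathcal Q}$, the convolution product $m\circ((\zeta_{\mathcal Q}^{\mathbf k}\circ\mathsf S_{\mathcal Q})\otimes\zeta_{\mathcal Q})\circ\Delta$. -}

module Defs where

open import Data.Bool using (Bool; true; false; _∧_; _∨_; not; if_then_else_)
open import Data.Bool.ListAction using (and)
open import Data.Nat as ℕ using (ℕ; zero; suc; _≤_; _∸_; _%_; _<ᵇ_)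
open import Data.Integer as ℤ using (ℤ; +_; -_)
open import Data.Fin using (Fin; toℕ)
open import Data.Product using (_×_; _,_)
open import Data.List as List using (List; []; _∷_; _++_; map; concatMap; cartesianProductWith; upTo; allFin; filterᵇ; length)
open import Data.Vec as Vec using (Vec; []; _∷_; zipWith; replicate; lookup; tabulate)
open import Data.Vec.Relation.Binary.Pointwise.Inductive using (Pointwise)
open import Relation.Binary.PropositionalEquality using (_≡_)
open import Relation.Nullary using (¬_)

data ℕ∞ : Set where
  fin : ℕ → ℕ∞
  ∞   : ℕ∞

data _≤∞_ : ℕ → ℕ∞ → Set where
  fin≤ : ∀ {m n} → m ≤ n → m ≤∞ fin n
  inf≤ : ∀ {m} → m ≤∞ ∞

_≤ᵇ∞_ : ℕ → ℕ∞ → Bool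
m ≤ᵇ∞ fin n = m ℕ.≤ᵇ n
m ≤ᵇ∞ ∞     = true

_≤ᵏ_ : ∀ {ℓ} → Vec ℕ ℓ → Vec ℕ∞ ℓ → Set
n ≤ᵏ k = Pointwise _≤∞_ n k

leqᵇ : ∀ {ℓ} → Vec ℕ ℓ → Vec ℕ∞ ℓ → Bool
leqᵇ []       []       = true
leqᵇ (a ∷ n)  (b ∷ k)  = (a ≤ᵇ∞ b) ∧ leqᵇ n k

∣_∣ᵥ : ∀ {ℓ} → Vec ℕ ℓ → ℕ
∣ v ∣ᵥ = Vec.sum v

zeroV : ∀ {ℓ} → Vec ℕ ℓ
zeroV = replicate _ 0

_+ᵥ_ : ∀ {ℓ} → Vec ℕ ℓ → Vec ℕ ℓ → Vec ℕ ℓ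
_+ᵥ_ = zipWith ℕ._+_

_∸ᵥ_ : ∀ {ℓ} → Vec ℕ ℓ → Vec ℕ ℓ → Vec ℕ ℓ
_∸ᵥ_ = zipWith _∸_

isZeroᵇ : ∀ {ℓ} → Vec ℕ ℓ → Bool
isZeroᵇ []          = true
isZeroᵇ (zero  ∷ v) = isZeroᵇ v
isZeroᵇ (suc _ ∷ v) = false

coord : ∀ {ℓ} → Fin ℓ → Vec ℕ ℓ
coord j = tabulate (λ a → if toℕ a ℕ.≡ᵇ toℕ j then 1 else 0)

leadCoord : ∀ {ℓ} → Vec ℕ ℓ → Vec ℕ ℓ
leadCoord []          = []
leadCoord (zero  ∷ v) = 0 ∷ leadCoord v
leadCoord (suc _ ∷ v) = 1 ∷ replicate _ 0

VC : ℕ → Set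
VC ℓ = List (Vec ℕ ℓ)

NonZeroV : ∀ {ℓ} → Vec ℕ ℓ → Set
NonZeroV v = ¬ (v ≡ zeroV)

ΣI : ∀ {ℓ} → VC ℓ → Vec ℕ ℓ
ΣI = List.foldr _+ᵥ_ zeroV

∣_∣c : ∀ {ℓ} → VC ℓ → ℕ
∣ I ∣c = ∣ ΣI I ∣ᵥ

sgn : ℕ → ℤ
sgn n = if n % 2 ℕ.≡ᵇ 0 then + 1 else - (+ 1)

Odd : ℕ → Set
Odd n = n % 2 ≡ 1

Even : ℕ → Set
Even n = n % 2 ≡ 0

-- QSym^(ℓ): elements as finite Z-linear combinations Σ c · M_J of the
-- monomial basis (all coefficients arising here are integers).

Lin : ℕ → Set
Lin ℓ = List (ℤ × VC ℓ)

oneL : ∀ {ℓ} → Lin ℓ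
oneL = (+ 1 , []) ∷ []

M : ∀ {ℓ} → VC ℓ → Lin ℓ
M J = (+ 1 , J) ∷ []

negL : ∀ {ℓ} → Lin ℓ → Lin ℓ
negL = map (λ { (c , J) → (- c , J) })

-- quasi-shuffle (stuffle): M_I · M_J = Σ_{K ∈ qsh I J} M_K
qsh : ∀ {ℓ} → VC ℓ → VC ℓ → List (VC ℓ)
qsh []      J       = J ∷ []
qsh (a ∷ I) []      = (a ∷ I) ∷ []
qsh (a ∷ I) (b ∷ J) =
  map (a ∷_) (qsh I (b ∷ J)) ++ map (b ∷_) (qsh (a ∷ I) J) ++ map ((a +ᵥ b) ∷_) (qsh I J)

_·L_ : ∀ {ℓ} → Lin ℓ → Lin ℓ → Lin ℓ
A ·L B = concatMap (λ { (c , I) → concatMap (λ { (d , J) → map (λ K → (c ℤ.* d , K)) (qsh I J) }) B }) A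

-- all deconcatenations I = J ++ K (the coproduct Δ M_I = Σ M_J ⊗ M_K)
splits : ∀ {A : Set} → List A → List (List A × List A)
splits []      = ([] , []) ∷ []
splits (a ∷ I) = ([] , a ∷ I) ∷ map (λ { (J , K) → (a ∷ J , K) }) (splits I)

-- antipode with fuel, via  Σ_{I = JK} M_J · S(M_K) = ε(M_I):
-- S(M_I) = - Σ_{I = JK, J ≠ ()} M_J · S(M_K)  for I ≠ ()
antipodeF : ∀ {ℓ} → ℕ → VC ℓ → Lin ℓ
antipodeF _       []      = oneL
antipodeF zero    (_ ∷ _) = []
antipodeF (suc n) (a ∷ I) =
  negL (concatMap (λ { (J , K) → M (a ∷ J) ·L antipodeF n K }) (splits I))

antipodeM : ∀ {ℓ} → VC ℓ → Lin ℓ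
antipodeM I = antipodeF (length I) I

evalL : ∀ {ℓ} → (VC ℓ → ℤ) → Lin ℓ → ℤ
evalL f = List.foldr (λ { (c , J) r → c ℤ.* f J ℤ.+ r }) (+ 0)

ζQ : ∀ {ℓ} → VC ℓ → ℤ
ζQ []          = + 1
ζQ (_ ∷ [])    = + 1
ζQ (_ ∷ _ ∷ _) = + 0

-- ζ_Q^k : ζ̄_Q on degrees n ≤ k, ζ_Q on other degrees (M_J has degree Σ J)
ζQk : ∀ {ℓ} → Vec ℕ∞ ℓ → VC ℓ → ℤ
ζQk k J = if leqᵇ (ΣI J) k then sgn ∣ J ∣c ℤ.* ζQ J else ζQ J

-- ν_Q^k = (ζ_Q^k ∘ S_Q) ζ_Q on M_I
νM : ∀ {ℓ} → Vec ℕ∞ ℓ → VC ℓ → ℤ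
νM k I = List.foldr (λ { (J , K) r → evalL (ζQk k) (antipodeM J) ℤ.* ζQ K ℤ.+ r }) (+ 0) (splits I)

νL : ∀ {ℓ} → Vec ℕ∞ ℓ → Lin ℓ → ℤ
νL k = evalL (νM k)

below : ∀ {ℓ} → Vec ℕ ℓ → List (Vec ℕ ℓ)
below []      = [] ∷ []
below (a ∷ v) = cartesianProductWith _∷_ (upTo (suc a)) (below v)

-- all vector compositions with column sum v (fuel ≥ |v| suffices)
compsF : ∀ {ℓ} → ℕ → Vec ℕ ℓ → List (VC ℓ)
compsF n v with isZeroᵇ v
... | true  = [] ∷ []
compsF zero    v | false = []
compsF (suc n) v | false =
  concatMap (λ u → map (u ∷_) (compsF n (v ∸ᵥ u))) (filterᵇ (λ u → not (isZeroᵇ u)) (below v))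

nzAt : ∀ {ℓ} → Vec ℕ ℓ → Fin ℓ → Bool
nzAt v a = not (lookup v a ℕ.≡ᵇ 0)

suppOrdᵇ : ∀ {ℓ} → Vec ℕ ℓ → Vec ℕ ℓ → Bool
suppOrdᵇ {ℓ} u w =
  and (concatMap (λ a → map (λ b → not (nzAt u a ∧ nzAt w b ∧ (toℕ b <ᵇ toℕ a))) (allFin ℓ)) (allFin ℓ))

suppChainᵇ : ∀ {ℓ} → VC ℓ → Bool
suppChainᵇ []      = true
suppChainᵇ (u ∷ J) = and (map (suppOrdᵇ u) J) ∧ suppChainᵇ J

blocks : ∀ {ℓ} → Vec ℕ ℓ → List (VC ℓ)
blocks i = filterᵇ suppChainᵇ (compsF ∣ i ∣ᵥ i)

-- all J with I ≼ J
refinements : ∀ {ℓ} → VC ℓ → List (VC ℓ)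
refinements []      = [] ∷ []
refinements (i ∷ I) = concatMap (λ B → map (B ++_) (refinements I)) (blocks i)

F : ∀ {ℓ} → VC ℓ → Lin ℓ
F I = map (λ J → (+ 1 , J)) (refinements I)

-- Let w = sgnᵏ k, i.e. w(n) = (-1)^|n| if n ≤ k and w(n) = 1 otherwise, so that ζ_Q^k(M_J) = w(ΣJ) ζ_Q(M_J).
-- Because ζ_Q vanishes on compositions of length ≥ 2, the recursion for the antipode gives
-- ζ_Q^k(S(M_J)) = (-1)^len(J) w(ΣJ), and in the deconcatenation of M_(J,i) only the splits with a
-- right factor of length ≤ 1 survive: ν^k(M_(J,i)) = (-1)^len(J) (w(ΣJ) - w(ΣJ + i)). Comparing
-- parities gives the values on the monomial basis.
--
-- The blocks refining a column i are the cuttings of the word e_0^(i_0) e_1^(i_1) ⋯ into consecutive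
-- pieces, and sums over them telescope along the prefixes of that word. Thus the blocks of i
-- contribute Σ (-1)^len(B) = -[|i| = 1], which kills F_I unless all columns but the last are
-- coordinate vectors, and for I = (E, i) of that shape ν^k(F_I) = (-1)^|E| (w(ΣE) - w(ΣE + e)) with e
-- the leading coordinate vector of i; this is 2 exactly under conditions (1)–(3), and 0 otherwise.

module Submission where

open import Defs

-- A separate module, since here _+_ is addition in ℤ while the statement uses ℕ's _+_.
module Lemmas where

  open import Data.Bool using (Bool; true; false; _∧_; _∨_; not; if_then_else_; T)
  open import Data.Bool.ListAction using (and)
  import Data.Bool.Properties as Boolₚ
  open import Data.Empty using (⊥-elim)
  open import Data.Fin using (Fin; zero; suc; toℕ)
  open import Data.Integer as ℤ using (ℤ; +_; -_; _+_; _*_; _-_)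
  import Data.Integer.Properties as ℤₚ
  open import Data.Integer.Tactic.RingSolver using (solve-∀)
  open import Data.List as List
    using (List; []; _∷_; _++_; map; concatMap; filterᵇ; length; _∷ʳ_; upTo; allFin; cartesianProductWith; initLast; _∷ʳ′_)
  import Data.List.Properties as Listₚ
  open import Data.List.Relation.Unary.All as All using (All; []; _∷_)
  import Data.List.Relation.Unary.All.Properties as Allₚ
  open import Data.Nat as ℕ using (ℕ; zero; suc; _∸_; _%_; z≤n; s≤s; _<ᵇ_)
  import Data.Nat.DivMod as ℕ
  import Data.Nat.Properties as ℕₚ
  open import Algebra.Properties.CommutativeSemigroup ℕₚ.+-commutativeSemigroup using () renaming (interchange to ℕ-+-interchange)
  open import Data.Product using (_×_; _,_; proj₁; proj₂; ∃-syntax)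
  open import Data.Sum using (_⊎_; inj₁; inj₂)
  open import Data.Unit using (tt)
  open import Data.Vec as Vec using (Vec; []; _∷_; replicate; tabulate)
  open import Data.Vec.Relation.Binary.Pointwise.Inductive using (Pointwise; []; _∷_)
  open import Function using (_∘_; id; Equivalence)
  open import Relation.Binary.PropositionalEquality
  open import Relation.Nullary using (¬_; Dec; yes; no)
  open import Relation.Nullary.Decidable using (T?)
  open ≡-Reasoning

  ∑ : {A : Set} → (A → ℤ) → List A → ℤ
  ∑ f []       = + 0
  ∑ f (x ∷ xs) = f x + ∑ f xs

  module _ {A : Set} where

    ∑-cong : {f g : A → ℤ} → (∀ x → f x ≡ g x) → ∀ xs → ∑ f xs ≡ ∑ g xs
    ∑-cong f≗g []       = refl
    ∑-cong f≗g (x ∷ xs) = cong₂ _+_ (f≗g x) (∑-cong f≗g xs)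

    ∑-congᴬ : {f g : A → ℤ} {xs : List A} → All (λ x → f x ≡ g x) xs → ∑ f xs ≡ ∑ g xs
    ∑-congᴬ []       = refl
    ∑-congᴬ (e ∷ es) = cong₂ _+_ e (∑-congᴬ es)

    ∑-zero : ∀ xs → ∑ (λ (_ : A) → + 0) xs ≡ + 0
    ∑-zero []       = refl
    ∑-zero (_ ∷ xs) = trans (ℤₚ.+-identityˡ _) (∑-zero xs)

    ∑-vanish : {f : A → ℤ} → (∀ x → f x ≡ + 0) → ∀ xs → ∑ f xs ≡ + 0
    ∑-vanish f≡0 xs = trans (∑-cong f≡0 xs) (∑-zero xs)

    ∑-vanishᴬ : {f : A → ℤ} {xs : List A} → All (λ x → f x ≡ + 0) xs → ∑ f xs ≡ + 0
    ∑-vanishᴬ {xs = xs} es = trans (∑-congᴬ es) (∑-zero xs)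

    ∑-++ : (f : A → ℤ) (xs ys : List A) → ∑ f (xs ++ ys) ≡ ∑ f xs + ∑ f ys
    ∑-++ f []       ys = sym (ℤₚ.+-identityˡ _)
    ∑-++ f (x ∷ xs) ys = trans (cong (_+_ (f x)) (∑-++ f xs ys)) (sym (ℤₚ.+-assoc (f x) _ _))

    ∑-*ˡ : (c : ℤ) (f : A → ℤ) (xs : List A) → ∑ (λ x → c * f x) xs ≡ c * ∑ f xs
    ∑-*ˡ c f []       = sym (ℤₚ.*-zeroʳ c)
    ∑-*ˡ c f (x ∷ xs) = trans (cong (_+_ (c * f x)) (∑-*ˡ c f xs)) (sym (ℤₚ.*-distribˡ-+ c (f x) _))

    ∑-*ʳ : (c : ℤ) (f : A → ℤ) (xs : List A) → ∑ (λ x → f x * c) xs ≡ ∑ f xs * c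
    ∑-*ʳ c f xs = begin
      ∑ (λ x → f x * c) xs  ≡⟨ ∑-cong (λ x → ℤₚ.*-comm (f x) c) xs ⟩
      ∑ (λ x → c * f x) xs  ≡⟨ ∑-*ˡ c f xs ⟩
      c * ∑ f xs            ≡⟨ ℤₚ.*-comm c (∑ f xs) ⟩
      ∑ f xs * c            ∎

    ∑-neg : (f : A → ℤ) (xs : List A) → ∑ (λ x → - f x) xs ≡ - ∑ f xs
    ∑-neg f []       = refl
    ∑-neg f (x ∷ xs) = trans (cong (_+_ (- f x)) (∑-neg f xs)) (sym (ℤₚ.neg-distrib-+ (f x) _))

    ∑-+ : (f g : A → ℤ) (xs : List A) → ∑ (λ x → f x + g x) xs ≡ ∑ f xs + ∑ g xs
    ∑-+ f g []       = refl
    ∑-+ f g (x ∷ xs) = trans (cong (_+_ (f x + g x)) (∑-+ f g xs)) (interchange (f x) (g x) _ _)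
      where
      interchange : ∀ a b c d → a + b + (c + d) ≡ a + c + (b + d)
      interchange = solve-∀

    ∑-filterᵇ : (f : A → ℤ) (p : A → Bool) (xs : List A) →
      ∑ f (filterᵇ p xs) ≡ ∑ (λ x → if p x then f x else + 0) xs
    ∑-filterᵇ f p []       = refl
    ∑-filterᵇ f p (x ∷ xs) with p x
    ... | true  = cong (_+_ (f x)) (∑-filterᵇ f p xs)
    ... | false = trans (∑-filterᵇ f p xs) (sym (ℤₚ.+-identityˡ _))

    ∑-if : (b : Bool) (f : A → ℤ) (xs : List A) →
      ∑ (λ x → if b then f x else + 0) xs ≡ (if b then ∑ f xs else + 0)
    ∑-if true  f xs = refl
    ∑-if false f xs = ∑-zero xs

  module _ {A B : Set} where

    ∑-map : (f : B → ℤ) (g : A → B) (xs : List A) → ∑ f (map g xs) ≡ ∑ (f ∘ g) xs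
    ∑-map f g []       = refl
    ∑-map f g (x ∷ xs) = cong (_+_ (f (g x))) (∑-map f g xs)

    ∑-concatMap : (f : B → ℤ) (g : A → List B) (xs : List A) →
      ∑ f (concatMap g xs) ≡ ∑ (λ x → ∑ f (g x)) xs
    ∑-concatMap f g []       = refl
    ∑-concatMap f g (x ∷ xs) = trans (∑-++ f (g x) _) (cong (_+_ (∑ f (g x))) (∑-concatMap f g xs))

  ∑-upTo-telescope : (g : ℕ → ℤ) (a : ℕ) → ∑ (λ x → g (suc x) - g x) (upTo a) ≡ g a - g 0
  ∑-upTo-telescope g zero    = sym (ℤₚ.+-inverseʳ (g 0))
  ∑-upTo-telescope g (suc a) = begin
    ∑ step (upTo (suc a))             ≡⟨ cong (∑ step) (sym (Listₚ.upTo-∷ʳ a)) ⟩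
    ∑ step (upTo a ∷ʳ a)              ≡⟨ ∑-++ step (upTo a) _ ⟩
    ∑ step (upTo a) + (step a + + 0)  ≡⟨ cong (_+ (step a + + 0)) (∑-upTo-telescope g a) ⟩
    g a - g 0 + (step a + + 0)        ≡⟨ cancel (g a) (g 0) (g (suc a)) ⟩
    g (suc a) - g 0                   ∎
    where
    step : ℕ → ℤ
    step x = g (suc x) - g x
    cancel : ∀ p q s → p - q + (s - p + + 0) ≡ s - q
    cancel = solve-∀

  evalL-∑ : ∀ {ℓ} (f : VC ℓ → ℤ) (A : Lin ℓ) → evalL f A ≡ ∑ (λ (c , J) → c * f J) A
  evalL-∑ f []            = refl
  evalL-∑ f ((c , J) ∷ A) = cong (_+_ (c * f J)) (evalL-∑ f A)

  %2-suc-suc : ∀ n → suc (suc n) % 2 ≡ n % 2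
  %2-suc-suc n = trans (cong (_% 2) (ℕₚ.+-comm 2 n)) (ℕ.[m+n]%n≡m%n n 2)

  sgn-suc-suc : ∀ n → sgn (suc (suc n)) ≡ sgn n
  sgn-suc-suc n = cong (λ r → if r ℕ.≡ᵇ 0 then + 1 else - + 1) (%2-suc-suc n)

  sgn-suc : ∀ n → sgn (suc n) ≡ - sgn n
  sgn-suc zero          = refl
  sgn-suc (suc zero)    = refl
  sgn-suc (suc (suc n)) = trans (sgn-suc-suc (suc n)) (trans (sgn-suc n) (cong -_ (sym (sgn-suc-suc n))))

  sgn-+ : ∀ m n → sgn (m ℕ.+ n) ≡ sgn m * sgn n
  sgn-+ zero    n = sym (ℤₚ.*-identityˡ _)
  sgn-+ (suc m) n = begin
    sgn (suc m ℕ.+ n)     ≡⟨ sgn-suc (m ℕ.+ n) ⟩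
    - sgn (m ℕ.+ n)       ≡⟨ cong -_ (sgn-+ m n) ⟩
    - (sgn m * sgn n)     ≡⟨ ℤₚ.neg-distribˡ-* (sgn m) (sgn n) ⟩
    - sgn m * sgn n       ≡⟨ cong (_* sgn n) (sym (sgn-suc m)) ⟩
    sgn (suc m) * sgn n   ∎

  sgn-*-self : ∀ n → sgn n * sgn n ≡ + 1
  sgn-*-self zero    = refl
  sgn-*-self (suc n) = begin
    sgn (suc n) * sgn (suc n) ≡⟨ cong (λ s → s * s) (sgn-suc n) ⟩
    - sgn n * - sgn n         ≡⟨ neg-*-neg (sgn n) ⟩
    sgn n * sgn n             ≡⟨ sgn-*-self n ⟩
    + 1                       ∎
    where
    neg-*-neg : ∀ x → - x * - x ≡ x * x
    neg-*-neg = solve-∀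

  sgn-odd : ∀ n → Odd n → sgn n ≡ - + 1
  sgn-odd n o rewrite o = refl

  sgn-even : ∀ n → Even n → sgn n ≡ + 1
  sgn-even n e rewrite e = refl

  odd⊎even : ∀ n → Odd n ⊎ Even n
  odd⊎even zero          = inj₂ refl
  odd⊎even (suc zero)    = inj₁ refl
  odd⊎even (suc (suc n)) rewrite %2-suc-suc n = odd⊎even n

  +ᵥ-identityˡ : ∀ {ℓ} (v : Vec ℕ ℓ) → zeroV +ᵥ v ≡ v
  +ᵥ-identityˡ []      = refl
  +ᵥ-identityˡ (a ∷ v) = cong (a ∷_) (+ᵥ-identityˡ v)

  +ᵥ-identityʳ : ∀ {ℓ} (v : Vec ℕ ℓ) → v +ᵥ zeroV ≡ v
  +ᵥ-identityʳ []      = refl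
  +ᵥ-identityʳ (a ∷ v) = cong₂ _∷_ (ℕₚ.+-identityʳ a) (+ᵥ-identityʳ v)

  +ᵥ-assoc : ∀ {ℓ} (u v w : Vec ℕ ℓ) → (u +ᵥ v) +ᵥ w ≡ u +ᵥ (v +ᵥ w)
  +ᵥ-assoc []      []      []      = refl
  +ᵥ-assoc (a ∷ u) (b ∷ v) (c ∷ w) = cong₂ _∷_ (ℕₚ.+-assoc a b c) (+ᵥ-assoc u v w)

  ∸ᵥ-identityʳ : ∀ {ℓ} (v : Vec ℕ ℓ) → v ∸ᵥ zeroV ≡ v
  ∸ᵥ-identityʳ []      = refl
  ∸ᵥ-identityʳ (a ∷ v) = cong (a ∷_) (∸ᵥ-identityʳ v)

  ∣zeroV∣ : ∀ {ℓ} → ∣ zeroV {ℓ} ∣ᵥ ≡ 0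
  ∣zeroV∣ {zero}  = refl
  ∣zeroV∣ {suc ℓ} = ∣zeroV∣ {ℓ}

  ∣+ᵥ∣ : ∀ {ℓ} (u v : Vec ℕ ℓ) → ∣ u +ᵥ v ∣ᵥ ≡ ∣ u ∣ᵥ ℕ.+ ∣ v ∣ᵥ
  ∣+ᵥ∣ []      []      = refl
  ∣+ᵥ∣ (a ∷ u) (b ∷ v) = trans (cong (a ℕ.+ b ℕ.+_) (∣+ᵥ∣ u v)) (ℕ-+-interchange a b _ _)

  isZeroᵇ-zeroV : ∀ {ℓ} → isZeroᵇ (zeroV {ℓ}) ≡ true
  isZeroᵇ-zeroV {zero}  = refl
  isZeroᵇ-zeroV {suc ℓ} = isZeroᵇ-zeroV {ℓ}

  isZeroᵇ⇒≡zeroV : ∀ {ℓ} (v : Vec ℕ ℓ) → isZeroᵇ v ≡ true → v ≡ zeroV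
  isZeroᵇ⇒≡zeroV []          _  = refl
  isZeroᵇ⇒≡zeroV (zero ∷ v)  e  = cong (0 ∷_) (isZeroᵇ⇒≡zeroV v e)

  NonZeroV⇒isZeroᵇ≡false : ∀ {ℓ} (v : Vec ℕ ℓ) → NonZeroV v → isZeroᵇ v ≡ false
  NonZeroV⇒isZeroᵇ≡false v nz with isZeroᵇ v in e
  ... | true  = ⊥-elim (nz (isZeroᵇ⇒≡zeroV v e))
  ... | false = refl

  isZeroᵇ≡false⇒1≤∣∣ : ∀ {ℓ} (v : Vec ℕ ℓ) → isZeroᵇ v ≡ false → 1 ℕ.≤ ∣ v ∣ᵥ
  isZeroᵇ≡false⇒1≤∣∣ (zero  ∷ v) e = isZeroᵇ≡false⇒1≤∣∣ v e
  isZeroᵇ≡false⇒1≤∣∣ (suc _ ∷ v) e = s≤s z≤n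

  ∣∣≡0⇒isZeroᵇ : ∀ {ℓ} (v : Vec ℕ ℓ) → ∣ v ∣ᵥ ≡ 0 → isZeroᵇ v ≡ true
  ∣∣≡0⇒isZeroᵇ []          _ = refl
  ∣∣≡0⇒isZeroᵇ (zero  ∷ v) e = ∣∣≡0⇒isZeroᵇ v e

  ∣leadCoord∣ : ∀ {ℓ} (v : Vec ℕ ℓ) → isZeroᵇ v ≡ false → ∣ leadCoord v ∣ᵥ ≡ 1
  ∣leadCoord∣          (zero  ∷ v) e = ∣leadCoord∣ v e
  ∣leadCoord∣ {suc ℓ} (suc _ ∷ v) _ = cong suc (∣zeroV∣ {ℓ})

  ΣI-++ : ∀ {ℓ} (J K : VC ℓ) → ΣI (J ++ K) ≡ ΣI J +ᵥ ΣI K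
  ΣI-++ []      K = sym (+ᵥ-identityˡ _)
  ΣI-++ (b ∷ J) K = trans (cong (b +ᵥ_) (ΣI-++ J K)) (sym (+ᵥ-assoc b _ _))

  ΣI-∷ʳ : ∀ {ℓ} (J : VC ℓ) (i : Vec ℕ ℓ) → ΣI (J ∷ʳ i) ≡ ΣI J +ᵥ i
  ΣI-∷ʳ J i = trans (ΣI-++ J (i ∷ [])) (cong (ΣI J +ᵥ_) (+ᵥ-identityʳ i))

  _≤ᵥ_ : ∀ {ℓ} → Vec ℕ ℓ → Vec ℕ ℓ → Set
  _≤ᵥ_ = Pointwise ℕ._≤_

  ≤ᵥ-+ᵥʳ : ∀ {ℓ} (u w : Vec ℕ ℓ) → u ≤ᵥ (u +ᵥ w)
  ≤ᵥ-+ᵥʳ []      []      = []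
  ≤ᵥ-+ᵥʳ (a ∷ u) (b ∷ w) = ℕₚ.m≤m+n a b ∷ ≤ᵥ-+ᵥʳ u w

  +ᵥ-monoʳ-≤ᵥ : ∀ {ℓ} {u v : Vec ℕ ℓ} (w : Vec ℕ ℓ) → u ≤ᵥ v → (w +ᵥ u) ≤ᵥ (w +ᵥ v)
  +ᵥ-monoʳ-≤ᵥ []      []       = []
  +ᵥ-monoʳ-≤ᵥ (c ∷ w) (p ∷ ps) = ℕₚ.+-monoʳ-≤ c p ∷ +ᵥ-monoʳ-≤ᵥ w ps

  zeroV-≤ᵥ : ∀ {ℓ} (v : Vec ℕ ℓ) → zeroV ≤ᵥ v
  zeroV-≤ᵥ []      = []
  zeroV-≤ᵥ (_ ∷ v) = z≤n ∷ zeroV-≤ᵥ v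

  leadCoord-≤ᵥ : ∀ {ℓ} (v : Vec ℕ ℓ) → leadCoord v ≤ᵥ v
  leadCoord-≤ᵥ []          = []
  leadCoord-≤ᵥ (zero  ∷ v) = z≤n ∷ leadCoord-≤ᵥ v
  leadCoord-≤ᵥ (suc _ ∷ v) = s≤s z≤n ∷ zeroV-≤ᵥ v

  ≤ᵥ-≤ᵏ-trans : ∀ {ℓ} {u v : Vec ℕ ℓ} {k : Vec ℕ∞ ℓ} → u ≤ᵥ v → v ≤ᵏ k → u ≤ᵏ k
  ≤ᵥ-≤ᵏ-trans []       []              = []
  ≤ᵥ-≤ᵏ-trans (p ∷ ps) (fin≤ q ∷ qs)  = fin≤ (ℕₚ.≤-trans p q) ∷ ≤ᵥ-≤ᵏ-trans ps qs
  ≤ᵥ-≤ᵏ-trans (_ ∷ ps) (inf≤ ∷ qs)    = inf≤ ∷ ≤ᵥ-≤ᵏ-trans ps qs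

  leqᵇ⇒≤ᵏ : ∀ {ℓ} (n : Vec ℕ ℓ) (k : Vec ℕ∞ ℓ) → leqᵇ n k ≡ true → n ≤ᵏ k
  leqᵇ⇒≤ᵏ []      []          _ = []
  leqᵇ⇒≤ᵏ (a ∷ n) (∞ ∷ k)     e = inf≤ ∷ leqᵇ⇒≤ᵏ n k e
  leqᵇ⇒≤ᵏ (a ∷ n) (fin b ∷ k) e =
    fin≤ (ℕₚ.≤ᵇ⇒≤ a b (proj₁ both)) ∷ leqᵇ⇒≤ᵏ n k (Equivalence.to Boolₚ.T-≡ (proj₂ both))
    where
    both : T (a ℕ.≤ᵇ b) × T (leqᵇ n k)
    both = Equivalence.to Boolₚ.T-∧ (Equivalence.from Boolₚ.T-≡ e)

  ≤ᵏ⇒leqᵇ : ∀ {ℓ} {n : Vec ℕ ℓ} {k : Vec ℕ∞ ℓ} → n ≤ᵏ k → leqᵇ n k ≡ true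
  ≤ᵏ⇒leqᵇ []               = refl
  ≤ᵏ⇒leqᵇ (fin≤ a≤b ∷ ps) = cong₂ _∧_ (Equivalence.to Boolₚ.T-≡ (ℕₚ.≤⇒≤ᵇ a≤b)) (≤ᵏ⇒leqᵇ ps)
  ≤ᵏ⇒leqᵇ (inf≤ ∷ ps)     = ≤ᵏ⇒leqᵇ ps

  ≤ᵏ? : ∀ {ℓ} (n : Vec ℕ ℓ) (k : Vec ℕ∞ ℓ) → Dec (n ≤ᵏ k)
  ≤ᵏ? n k with leqᵇ n k in e
  ... | true  = yes (leqᵇ⇒≤ᵏ n k e)
  ... | false = no (λ p → subst T (trans (sym (≤ᵏ⇒leqᵇ p)) e) tt)

  -- ζ_Q on the antipode

  module _ {ℓ : ℕ} where

    evalL-cong : {f g : VC ℓ → ℤ} → (∀ J → f J ≡ g J) → ∀ A → evalL f A ≡ evalL g A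
    evalL-cong f≗g []            = refl
    evalL-cong f≗g ((c , J) ∷ A) = cong₂ (λ x y → c * x + y) (f≗g J) (evalL-cong f≗g A)

    evalL-zero : ∀ A → evalL (λ (_ : VC ℓ) → + 0) A ≡ + 0
    evalL-zero []            = refl
    evalL-zero ((c , _) ∷ A) = cong₂ _+_ (ℤₚ.*-zeroʳ c) (evalL-zero A)

    evalL-negL : (f : VC ℓ → ℤ) (A : Lin ℓ) → evalL f (negL A) ≡ - evalL f A
    evalL-negL f []            = refl
    evalL-negL f ((c , J) ∷ A) = begin
      - c * f J + evalL f (negL A)  ≡⟨ cong₂ _+_ (sym (ℤₚ.neg-distribˡ-* c (f J))) (evalL-negL f A) ⟩
      - (c * f J) + - evalL f A     ≡⟨ ℤₚ.neg-distrib-+ (c * f J) (evalL f A) ⟨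
      - (c * f J + evalL f A)       ∎

    evalL-++ : (f : VC ℓ → ℤ) (A B : Lin ℓ) → evalL f (A ++ B) ≡ evalL f A + evalL f B
    evalL-++ f A B = begin
      evalL f (A ++ B)       ≡⟨ evalL-∑ f (A ++ B) ⟩
      ∑ _ (A ++ B)           ≡⟨ ∑-++ _ A B ⟩
      ∑ _ A + ∑ _ B          ≡⟨ cong₂ _+_ (evalL-∑ f A) (evalL-∑ f B) ⟨
      evalL f A + evalL f B  ∎

    evalL-concatMap : {X : Set} (f : VC ℓ → ℤ) (g : X → Lin ℓ) (xs : List X) →
      evalL f (concatMap g xs) ≡ ∑ (evalL f ∘ g) xs
    evalL-concatMap f g []       = refl
    evalL-concatMap f g (x ∷ xs) = trans (evalL-++ f (g x) _) (cong (_+_ (evalL f (g x))) (evalL-concatMap f g xs))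

    evalL-M-·L : (f : VC ℓ → ℤ) (I : VC ℓ) (X : Lin ℓ) →
      evalL f (M I ·L X) ≡ evalL (λ K → ∑ f (qsh I K)) X
    evalL-M-·L f I X = begin
      evalL f (M I ·L X)
        ≡⟨ evalL-concatMap f (λ (c , I′) → concatMap (λ (d , K) → map (λ L → (c * d , L)) (qsh I′ K)) X) (M I) ⟩
      evalL f (concatMap (λ (d , K) → map (λ L → (+ 1 * d , L)) (qsh I K)) X) + + 0
        ≡⟨ ℤₚ.+-identityʳ _ ⟩
      evalL f (concatMap (λ (d , K) → map (λ L → (+ 1 * d , L)) (qsh I K)) X)
        ≡⟨ evalL-concatMap f (λ (d , K) → map (λ L → (+ 1 * d , L)) (qsh I K)) X ⟩
      ∑ (λ (d , K) → evalL f (map (λ L → (+ 1 * d , L)) (qsh I K))) X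
        ≡⟨ ∑-cong (λ (d , K) → scaled d K) X ⟩
      ∑ (λ (d , K) → d * ∑ f (qsh I K)) X
        ≡⟨ evalL-∑ _ X ⟨
      evalL (λ K → ∑ f (qsh I K)) X ∎
      where
      scaled : ∀ d K → evalL f (map (λ L → (+ 1 * d , L)) (qsh I K)) ≡ d * ∑ f (qsh I K)
      scaled d K = begin
        evalL f (map (λ L → (+ 1 * d , L)) (qsh I K)) ≡⟨ evalL-∑ f (map (λ L → (+ 1 * d , L)) (qsh I K)) ⟩
        ∑ (λ (c , L) → c * f L) (map (λ L → (+ 1 * d , L)) (qsh I K)) ≡⟨ ∑-map _ _ (qsh I K) ⟩
        ∑ (λ L → + 1 * d * f L) (qsh I K)             ≡⟨ ∑-*ˡ (+ 1 * d) f (qsh I K) ⟩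
        + 1 * d * ∑ f (qsh I K)                       ≡⟨ cong (_* ∑ f (qsh I K)) (ℤₚ.*-identityˡ d) ⟩
        d * ∑ f (qsh I K)                             ∎

  data NonEmpty {A : Set} : List A → Set where
    nonEmpty : ∀ {x xs} → NonEmpty (x ∷ xs)

  module _ {ℓ : ℕ} where

    ζQ-∷-nonEmpty : {x : Vec ℕ ℓ} {L : VC ℓ} → NonEmpty L → ζQ (x ∷ L) ≡ + 0
    ζQ-∷-nonEmpty nonEmpty = refl

    map-∷-nonEmpty : (x : Vec ℕ ℓ) (Ls : List (VC ℓ)) → All NonEmpty (map (x ∷_) Ls)
    map-∷-nonEmpty x Ls = Allₚ.map⁺ (All.universal (λ _ → nonEmpty) Ls)

    qsh-∷-∷-nonEmpty : ∀ a I b J → All NonEmpty (qsh {ℓ} (a ∷ I) (b ∷ J))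
    qsh-∷-∷-nonEmpty a I b J =
      Allₚ.++⁺ (map-∷-nonEmpty a (qsh I (b ∷ J)))
        (Allₚ.++⁺ (map-∷-nonEmpty b (qsh (a ∷ I) J)) (map-∷-nonEmpty (a +ᵥ b) (qsh I J)))

    qsh-nonEmptyˡ : ∀ a I J → All NonEmpty (qsh {ℓ} (a ∷ I) J)
    qsh-nonEmptyˡ a I []      = nonEmpty ∷ []
    qsh-nonEmptyˡ a I (b ∷ J) = qsh-∷-∷-nonEmpty a I b J

    ζQ-vanishes-on-map-∷ : (x : Vec ℕ ℓ) {Ls : List (VC ℓ)} → All NonEmpty Ls →
      All (λ L → ζQ L ≡ + 0) (map (x ∷_) Ls)
    ζQ-vanishes-on-map-∷ x ne = Allₚ.map⁺ (All.map ζQ-∷-nonEmpty ne)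

    ζQ-vanishes-on-qsh-long : ∀ a b J K → All (λ L → ζQ L ≡ + 0) (qsh {ℓ} (a ∷ b ∷ J) K)
    ζQ-vanishes-on-qsh-long a b J []      = refl ∷ []
    ζQ-vanishes-on-qsh-long a b J (c ∷ K) =
      Allₚ.++⁺ (ζQ-vanishes-on-map-∷ a (qsh-nonEmptyˡ b J (c ∷ K)))
        (Allₚ.++⁺ (ζQ-vanishes-on-map-∷ c (qsh-nonEmptyˡ a (b ∷ J) K))
                  (ζQ-vanishes-on-map-∷ (a +ᵥ c) (qsh-nonEmptyˡ b J K)))

    weightedζ : (Vec ℕ ℓ → ℤ) → VC ℓ → ℤ
    weightedζ q J = q (ΣI J) * ζQ J

    ∑-weightedζ-vanish : (q : Vec ℕ ℓ → ℤ) {Ls : List (VC ℓ)} → All (λ L → ζQ L ≡ + 0) Ls →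
      ∑ (weightedζ q) Ls ≡ + 0
    ∑-weightedζ-vanish q es = ∑-vanishᴬ (All.map (λ {L} e → trans (cong (q (ΣI L) *_) e) (ℤₚ.*-zeroʳ (q (ΣI L)))) es)

    ∑-weightedζ-qsh-single : (q : Vec ℕ ℓ → ℤ) (a : Vec ℕ ℓ) (K : VC ℓ) →
      ∑ (weightedζ q) (qsh (a ∷ []) K) ≡ weightedζ (q ∘ (a +ᵥ_)) K
    ∑-weightedζ-qsh-single q a []          = ℤₚ.+-identityʳ _
    ∑-weightedζ-qsh-single q a (b ∷ [])    = begin
      weightedζ q (a ∷ b ∷ []) + (weightedζ q (b ∷ a ∷ []) + (weightedζ q ((a +ᵥ b) ∷ []) + + 0))
        ≡⟨ cong₂ (λ x y → x + (y + (weightedζ q ((a +ᵥ b) ∷ []) + + 0)))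
                 (ℤₚ.*-zeroʳ (q (ΣI (a ∷ b ∷ [])))) (ℤₚ.*-zeroʳ (q (ΣI (b ∷ a ∷ [])))) ⟩
      + 0 + (+ 0 + (weightedζ q ((a +ᵥ b) ∷ []) + + 0))
        ≡⟨ trans (ℤₚ.+-identityˡ _) (trans (ℤₚ.+-identityˡ _) (ℤₚ.+-identityʳ _)) ⟩
      weightedζ q ((a +ᵥ b) ∷ [])
        ≡⟨ cong (λ v → q v * + 1) (+ᵥ-assoc a b zeroV) ⟩
      weightedζ (q ∘ (a +ᵥ_)) (b ∷ []) ∎
    ∑-weightedζ-qsh-single q a (b ∷ c ∷ K) = begin
      ∑ (weightedζ q) (qsh (a ∷ []) (b ∷ c ∷ K))
        ≡⟨ ∑-weightedζ-vanish q {qsh (a ∷ []) (b ∷ c ∷ K)}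
             (refl ∷ Allₚ.++⁺ (ζQ-vanishes-on-map-∷ b (qsh-nonEmptyˡ a [] (c ∷ K))) (refl ∷ [])) ⟩
      + 0
        ≡⟨ ℤₚ.*-zeroʳ (q (a +ᵥ ΣI (b ∷ c ∷ K))) ⟨
      weightedζ (q ∘ (a +ᵥ_)) (b ∷ c ∷ K) ∎

    evalL-weightedζ-M-single-·L : (q : Vec ℕ ℓ → ℤ) (a : Vec ℕ ℓ) (X : Lin ℓ) →
      evalL (weightedζ q) (M (a ∷ []) ·L X) ≡ evalL (weightedζ (q ∘ (a +ᵥ_))) X
    evalL-weightedζ-M-single-·L q a X =
      trans (evalL-M-·L _ (a ∷ []) X) (evalL-cong (∑-weightedζ-qsh-single q a) X)

    evalL-weightedζ-M-long-·L : (q : Vec ℕ ℓ → ℤ) (a b : Vec ℕ ℓ) (J : VC ℓ) (X : Lin ℓ) →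
      evalL (weightedζ q) (M (a ∷ b ∷ J) ·L X) ≡ + 0
    evalL-weightedζ-M-long-·L q a b J X = begin
      evalL (weightedζ q) (M (a ∷ b ∷ J) ·L X)                  ≡⟨ evalL-M-·L _ (a ∷ b ∷ J) X ⟩
      evalL (λ K → ∑ (weightedζ q) (qsh (a ∷ b ∷ J) K)) X       ≡⟨ evalL-cong (λ K → ∑-weightedζ-vanish q (ζQ-vanishes-on-qsh-long a b J K)) X ⟩
      evalL (λ _ → + 0) X                                        ≡⟨ evalL-zero X ⟩
      + 0                                                        ∎

    ∑-splits-head : (g : VC ℓ × VC ℓ → ℤ) (I : VC ℓ) → (∀ b J K → g (b ∷ J , K) ≡ + 0) →
      ∑ g (splits I) ≡ g ([] , I)
    ∑-splits-head g []      _    = ℤₚ.+-identityʳ _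
    ∑-splits-head g (b ∷ I) g≡0 = begin
      g ([] , b ∷ I) + ∑ g (map _ (splits I))             ≡⟨ cong (_+_ (g ([] , b ∷ I))) (∑-map g _ (splits I)) ⟩
      g ([] , b ∷ I) + ∑ _ (splits I)                     ≡⟨ cong (_+_ (g ([] , b ∷ I))) (∑-vanish (λ (J , K) → g≡0 b J K) (splits I)) ⟩
      g ([] , b ∷ I) + + 0                                ≡⟨ ℤₚ.+-identityʳ _ ⟩
      g ([] , b ∷ I)                                      ∎

    -- Only the split J = [] survives: ζ_Q vanishes on every quasi-shuffle with a factor of length ≥ 2.
    weightedζ-antipodeF : ∀ n (I : VC ℓ) → length I ℕ.≤ n → (q : Vec ℕ ℓ → ℤ) →
      evalL (weightedζ q) (antipodeF n I) ≡ q (ΣI I) * sgn (length I)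
    weightedζ-antipodeF n       []      _          q = trans (ℤₚ.+-identityʳ _) (ℤₚ.*-identityˡ _)
    weightedζ-antipodeF (suc n) (a ∷ I) (s≤s len≤n) q = begin
      evalL (weightedζ q) (negL (concatMap term (splits I)))
        ≡⟨ evalL-negL _ (concatMap term (splits I)) ⟩
      - evalL (weightedζ q) (concatMap term (splits I))
        ≡⟨ cong -_ (evalL-concatMap _ term (splits I)) ⟩
      - ∑ (evalL (weightedζ q) ∘ term) (splits I)
        ≡⟨ cong -_ (∑-splits-head _ I (λ b J K → evalL-weightedζ-M-long-·L q a b J (antipodeF n K))) ⟩
      - evalL (weightedζ q) (M (a ∷ []) ·L antipodeF n I)
        ≡⟨ cong -_ (evalL-weightedζ-M-single-·L q a (antipodeF n I)) ⟩
      - evalL (weightedζ (q ∘ (a +ᵥ_))) (antipodeF n I)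
        ≡⟨ cong -_ (weightedζ-antipodeF n I len≤n (q ∘ (a +ᵥ_))) ⟩
      - (q (a +ᵥ ΣI I) * sgn (length I))
        ≡⟨ ℤₚ.neg-distribʳ-* (q (a +ᵥ ΣI I)) (sgn (length I)) ⟩
      q (a +ᵥ ΣI I) * - sgn (length I)
        ≡⟨ cong (q (a +ᵥ ΣI I) *_) (sgn-suc (length I)) ⟨
      q (a +ᵥ ΣI I) * sgn (suc (length I)) ∎
      where
      term : VC ℓ × VC ℓ → Lin ℓ
      term (J , K) = M (a ∷ J) ·L antipodeF n K

  -- ν^k on the monomial basis

  sgnᵏ : ∀ {ℓ} → Vec ℕ∞ ℓ → Vec ℕ ℓ → ℤ
  sgnᵏ k x = if leqᵇ x k then sgn ∣ x ∣ᵥ else + 1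

  module _ {ℓ : ℕ} (k : Vec ℕ∞ ℓ) where

    sgnᵏ-≤ : {x : Vec ℕ ℓ} → x ≤ᵏ k → sgnᵏ k x ≡ sgn ∣ x ∣ᵥ
    sgnᵏ-≤ x≤k rewrite ≤ᵏ⇒leqᵇ x≤k = refl

    sgnᵏ-≰ : {x : Vec ℕ ℓ} → ¬ x ≤ᵏ k → sgnᵏ k x ≡ + 1
    sgnᵏ-≰ {x} x≰k with leqᵇ x k in e
    ... | true  = ⊥-elim (x≰k (leqᵇ⇒≤ᵏ x k e))
    ... | false = refl

    ζQk≡weightedζ : (J : VC ℓ) → ζQk k J ≡ weightedζ (sgnᵏ k) J
    ζQk≡weightedζ J with leqᵇ (ΣI J) k
    ... | true  = refl
    ... | false = sym (ℤₚ.*-identityˡ _)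

    ζQk-antipodeM : (J : VC ℓ) → evalL (ζQk k) (antipodeM J) ≡ sgnᵏ k (ΣI J) * sgn (length J)
    ζQk-antipodeM J =
      trans (evalL-cong ζQk≡weightedζ (antipodeM J)) (weightedζ-antipodeF (length J) J ℕₚ.≤-refl (sgnᵏ k))

  -- ν^k(M_I) after evaluating ζ^k ∘ S_Q on the left tensor factor (ζQk-antipodeM), for a general weight h.
  νʰ : ∀ {ℓ} → (Vec ℕ ℓ → ℤ) → VC ℓ → ℤ
  νʰ h I = ∑ (λ (J , K) → h (ΣI J) * sgn (length J) * ζQ K) (splits I)

  νM≡νʰ : ∀ {ℓ} (k : Vec ℕ∞ ℓ) (I : VC ℓ) → νM k I ≡ νʰ (sgnᵏ k) I
  νM≡νʰ k I = go (splits I)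
    where
    go : ∀ xs → List.foldr (λ { (J , K) r → evalL (ζQk k) (antipodeM J) * ζQ K + r }) (+ 0) xs
                ≡ ∑ (λ (J , K) → sgnᵏ k (ΣI J) * sgn (length J) * ζQ K) xs
    go []             = refl
    go ((J , K) ∷ xs) = cong₂ _+_ (cong (_* ζQ K) (ζQk-antipodeM k J)) (go xs)

  νL-M : ∀ {ℓ} (k : Vec ℕ∞ ℓ) (I : VC ℓ) → νL k (M I) ≡ νM k I
  νL-M k I = trans (ℤₚ.+-identityʳ _) (ℤₚ.*-identityˡ _)

  module _ {ℓ : ℕ} where

    νʰ-cong : {h h′ : Vec ℕ ℓ → ℤ} → (∀ x → h x ≡ h′ x) → ∀ I → νʰ h I ≡ νʰ h′ I
    νʰ-cong h≗h′ I = ∑-cong (λ (J , K) → cong (λ z → z * sgn (length J) * ζQ K) (h≗h′ (ΣI J))) (splits I)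

    νʰ-∷-nonEmpty : (h : Vec ℕ ℓ → ℤ) (b : Vec ℕ ℓ) {X : VC ℓ} → NonEmpty X →
      νʰ h (b ∷ X) ≡ - νʰ (h ∘ (b +ᵥ_)) X
    νʰ-∷-nonEmpty h b {X} ne = begin
      h zeroV * + 1 * ζQ (b ∷ X) + ∑ _ (map _ (splits X))
        ≡⟨ cong₂ _+_ (trans (cong (h zeroV * + 1 *_) (ζQ-∷-nonEmpty ne)) (ℤₚ.*-zeroʳ (h zeroV * + 1)))
                     (∑-map _ _ (splits X)) ⟩
      + 0 + ∑ (λ (J , K) → h (b +ᵥ ΣI J) * sgn (suc (length J)) * ζQ K) (splits X)
        ≡⟨ ℤₚ.+-identityˡ _ ⟩
      ∑ (λ (J , K) → h (b +ᵥ ΣI J) * sgn (suc (length J)) * ζQ K) (splits X)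
        ≡⟨ ∑-cong (λ (J , K) → flip-sign (h (b +ᵥ ΣI J)) (length J) (ζQ K)) (splits X) ⟩
      ∑ (λ (J , K) → - (h (b +ᵥ ΣI J) * sgn (length J) * ζQ K)) (splits X)
        ≡⟨ ∑-neg _ (splits X) ⟩
      - νʰ (h ∘ (b +ᵥ_)) X ∎
      where
      flip-sign : ∀ a n z → a * sgn (suc n) * z ≡ - (a * sgn n * z)
      flip-sign a n z = trans (cong (λ s → a * s * z) (sgn-suc n)) (neg-middle a (sgn n) z)
        where
        neg-middle : ∀ a s z → a * - s * z ≡ - (a * s * z)
        neg-middle = solve-∀

    νʰ-∷ʳ : (h : Vec ℕ ℓ → ℤ) (J : VC ℓ) (i : Vec ℕ ℓ) →
      νʰ h (J ∷ʳ i) ≡ sgn (length J) * (h (ΣI J) - h (ΣI J +ᵥ i))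
    νʰ-∷ʳ h []      i = trans (two-terms (h zeroV) (h (i +ᵥ zeroV))) (cong (λ v → + 1 * (h zeroV - h v)) lemma)
      where
      two-terms : ∀ x y → x * + 1 * + 1 + (y * - + 1 * + 1 + + 0) ≡ + 1 * (x - y)
      two-terms = solve-∀
      lemma : i +ᵥ zeroV ≡ zeroV +ᵥ i
      lemma = trans (+ᵥ-identityʳ i) (sym (+ᵥ-identityˡ i))
    νʰ-∷ʳ h (b ∷ J) i = begin
      νʰ h (b ∷ J ∷ʳ i)
        ≡⟨ νʰ-∷-nonEmpty h b (∷ʳ-nonEmpty J) ⟩
      - νʰ (h ∘ (b +ᵥ_)) (J ∷ʳ i)
        ≡⟨ cong -_ (νʰ-∷ʳ (h ∘ (b +ᵥ_)) J i) ⟩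
      - (sgn (length J) * (h (b +ᵥ ΣI J) - h (b +ᵥ (ΣI J +ᵥ i))))
        ≡⟨ ℤₚ.neg-distribˡ-* (sgn (length J)) _ ⟩
      - sgn (length J) * (h (b +ᵥ ΣI J) - h (b +ᵥ (ΣI J +ᵥ i)))
        ≡⟨ cong₂ (λ s v → s * (h (b +ᵥ ΣI J) - h v)) (sgn-suc (length J)) (+ᵥ-assoc b (ΣI J) i) ⟨
      sgn (suc (length J)) * (h (b +ᵥ ΣI J) - h ((b +ᵥ ΣI J) +ᵥ i)) ∎
      where
      ∷ʳ-nonEmpty : ∀ J → NonEmpty (J ∷ʳ i)
      ∷ʳ-nonEmpty []      = nonEmpty
      ∷ʳ-nonEmpty (_ ∷ _) = nonEmpty

    νʰ-++ : (h : Vec ℕ ℓ → ℤ) (B : VC ℓ) {J : VC ℓ} → NonEmpty J →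
      νʰ h (B ++ J) ≡ sgn (length B) * νʰ (h ∘ (ΣI B +ᵥ_)) J
    νʰ-++ h []      {J} ne = trans (νʰ-cong (λ x → cong h (sym (+ᵥ-identityˡ x))) J) (sym (ℤₚ.*-identityˡ _))
    νʰ-++ h (b ∷ B) {J} ne = begin
      νʰ h (b ∷ B ++ J)
        ≡⟨ νʰ-∷-nonEmpty h b (++-nonEmpty B) ⟩
      - νʰ (h ∘ (b +ᵥ_)) (B ++ J)
        ≡⟨ cong -_ (νʰ-++ (h ∘ (b +ᵥ_)) B ne) ⟩
      - (sgn (length B) * νʰ (h ∘ (b +ᵥ_) ∘ (ΣI B +ᵥ_)) J)
        ≡⟨ ℤₚ.neg-distribˡ-* (sgn (length B)) _ ⟩
      - sgn (length B) * νʰ (h ∘ (b +ᵥ_) ∘ (ΣI B +ᵥ_)) J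
        ≡⟨ cong₂ _*_ (sym (sgn-suc (length B))) (νʰ-cong (λ x → cong h (sym (+ᵥ-assoc b (ΣI B) x))) J) ⟩
      sgn (suc (length B)) * νʰ (h ∘ ((b +ᵥ ΣI B) +ᵥ_)) J ∎
      where
      ++-nonEmpty : ∀ B → NonEmpty (B ++ J)
      ++-nonEmpty []      = ne
      ++-nonEmpty (_ ∷ _) = nonEmpty

  length-∷ʳ : ∀ {A : Set} (J : List A) (i : A) → length (J ∷ʳ i) ≡ suc (length J)
  length-∷ʳ []      i = refl
  length-∷ʳ (_ ∷ J) i = cong suc (length-∷ʳ J i)

  νL-M-∷ʳ : ∀ {ℓ} (k : Vec ℕ∞ ℓ) (J : VC ℓ) (i : Vec ℕ ℓ) →
    νL k (M (J ∷ʳ i)) ≡ sgn (length J) * (sgnᵏ k (ΣI J) - sgnᵏ k (ΣI J +ᵥ i))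
  νL-M-∷ʳ k J i = trans (νL-M k (J ∷ʳ i)) (trans (νM≡νʰ k (J ∷ʳ i)) (νʰ-∷ʳ (sgnᵏ k) J i))

  module _ {ℓ : ℕ} (k : Vec ℕ∞ ℓ) (J : VC ℓ) (i : Vec ℕ ℓ) where

    private
      P S : Vec ℕ ℓ
      P = ΣI J
      S = ΣI J +ᵥ i

      S≤ᵏ : ΣI (J ∷ʳ i) ≤ᵏ k → S ≤ᵏ k
      S≤ᵏ = subst (_≤ᵏ k) (ΣI-∷ʳ J i)

      sgn∣S∣ : sgn ∣ S ∣ᵥ ≡ sgn ∣ P ∣ᵥ * sgn ∣ i ∣ᵥ
      sgn∣S∣ = trans (cong sgn (∣+ᵥ∣ P i)) (sgn-+ ∣ P ∣ᵥ ∣ i ∣ᵥ)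

    νL-M-odd-last : Odd ∣ i ∣ᵥ × ΣI (J ∷ʳ i) ≤ᵏ k →
      νL k (M (J ∷ʳ i)) ≡ + 2 * sgn (length (J ∷ʳ i) ℕ.+ ∣ J ∷ʳ i ∣c)
    νL-M-odd-last (odd , ≤k) = begin
      νL k (M (J ∷ʳ i))
        ≡⟨ νL-M-∷ʳ k J i ⟩
      sgn (length J) * (sgnᵏ k P - sgnᵏ k S)
        ≡⟨ cong₂ (λ x y → sgn (length J) * (x - y)) (sgnᵏ-≤ k (≤ᵥ-≤ᵏ-trans (≤ᵥ-+ᵥʳ P i) (S≤ᵏ ≤k)))
                                                     (trans (sgnᵏ-≤ k (S≤ᵏ ≤k)) sgn∣S∣′) ⟩
      sgn (length J) * (sgn ∣ P ∣ᵥ - sgn ∣ P ∣ᵥ * - + 1)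
        ≡⟨ double (sgn (length J)) (sgn ∣ P ∣ᵥ) ⟩
      + 2 * (- sgn (length J) * (sgn ∣ P ∣ᵥ * - + 1))
        ≡⟨ cong (+ 2 *_) total-sign ⟨
      + 2 * sgn (length (J ∷ʳ i) ℕ.+ ∣ J ∷ʳ i ∣c) ∎
      where
      sgn∣S∣′ : sgn ∣ S ∣ᵥ ≡ sgn ∣ P ∣ᵥ * - + 1
      sgn∣S∣′ = trans sgn∣S∣ (cong (sgn ∣ P ∣ᵥ *_) (sgn-odd ∣ i ∣ᵥ odd))
      double : ∀ a b → a * (b - b * - + 1) ≡ + 2 * (- a * (b * - + 1))
      double = solve-∀
      total-sign : sgn (length (J ∷ʳ i) ℕ.+ ∣ J ∷ʳ i ∣c) ≡ - sgn (length J) * (sgn ∣ P ∣ᵥ * - + 1)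
      total-sign = begin
        sgn (length (J ∷ʳ i) ℕ.+ ∣ J ∷ʳ i ∣c)  ≡⟨ cong₂ (λ n v → sgn (n ℕ.+ ∣ v ∣ᵥ)) (length-∷ʳ J i) (ΣI-∷ʳ J i) ⟩
        sgn (suc (length J) ℕ.+ ∣ S ∣ᵥ)         ≡⟨ sgn-+ (suc (length J)) ∣ S ∣ᵥ ⟩
        sgn (suc (length J)) * sgn ∣ S ∣ᵥ       ≡⟨ cong₂ _*_ (sgn-suc (length J)) sgn∣S∣′ ⟩
        - sgn (length J) * (sgn ∣ P ∣ᵥ * - + 1) ∎

    νL-M-odd-init : Odd ∣ J ∣c × ΣI J ≤ᵏ k × ¬ ΣI (J ∷ʳ i) ≤ᵏ k →
      νL k (M (J ∷ʳ i)) ≡ + 2 * sgn (length (J ∷ʳ i))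
    νL-M-odd-init (odd , P≤k , ≰k) = begin
      νL k (M (J ∷ʳ i))
        ≡⟨ νL-M-∷ʳ k J i ⟩
      sgn (length J) * (sgnᵏ k P - sgnᵏ k S)
        ≡⟨ cong₂ (λ x y → sgn (length J) * (x - y)) (trans (sgnᵏ-≤ k P≤k) (sgn-odd ∣ P ∣ᵥ odd))
                                                     (sgnᵏ-≰ k (≰k ∘ subst (_≤ᵏ k) (sym (ΣI-∷ʳ J i)))) ⟩
      sgn (length J) * (- + 1 - + 1)
        ≡⟨ double (sgn (length J)) ⟩
      + 2 * - sgn (length J)
        ≡⟨ cong (+ 2 *_) (trans (cong sgn (length-∷ʳ J i)) (sgn-suc (length J))) ⟨
      + 2 * sgn (length (J ∷ʳ i)) ∎
      where
      double : ∀ a → a * (- + 1 - + 1) ≡ + 2 * - a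
      double = solve-∀

    νL-M-otherwise : ¬ (Odd ∣ i ∣ᵥ × ΣI (J ∷ʳ i) ≤ᵏ k) → ¬ (Odd ∣ J ∣c × ΣI J ≤ᵏ k × ¬ ΣI (J ∷ʳ i) ≤ᵏ k) →
      νL k (M (J ∷ʳ i)) ≡ + 0
    νL-M-otherwise ¬last ¬init = begin
      νL k (M (J ∷ʳ i))                       ≡⟨ νL-M-∷ʳ k J i ⟩
      sgn (length J) * (sgnᵏ k P - sgnᵏ k S)  ≡⟨ cong (λ x → sgn (length J) * (x - sgnᵏ k S)) sgnᵏ-P≡sgnᵏ-S ⟩
      sgn (length J) * (sgnᵏ k S - sgnᵏ k S)  ≡⟨ cong (sgn (length J) *_) (ℤₚ.+-inverseʳ (sgnᵏ k S)) ⟩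
      sgn (length J) * + 0                    ≡⟨ ℤₚ.*-zeroʳ (sgn (length J)) ⟩
      + 0                                     ∎
      where
      S≤ᵏ⁻¹ : S ≤ᵏ k → ΣI (J ∷ʳ i) ≤ᵏ k
      S≤ᵏ⁻¹ = subst (_≤ᵏ k) (sym (ΣI-∷ʳ J i))
      sgnᵏ-P≡sgnᵏ-S : sgnᵏ k P ≡ sgnᵏ k S
      sgnᵏ-P≡sgnᵏ-S with ≤ᵏ? S k | ≤ᵏ? P k
      ... | yes S≤k | _ with odd⊎even ∣ i ∣ᵥ
      ...   | inj₁ odd  = ⊥-elim (¬last (odd , S≤ᵏ⁻¹ S≤k))
      ...   | inj₂ even = begin
        sgnᵏ k P                 ≡⟨ sgnᵏ-≤ k (≤ᵥ-≤ᵏ-trans (≤ᵥ-+ᵥʳ P i) S≤k) ⟩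
        sgn ∣ P ∣ᵥ               ≡⟨ ℤₚ.*-identityʳ _ ⟨
        sgn ∣ P ∣ᵥ * + 1         ≡⟨ cong (sgn ∣ P ∣ᵥ *_) (sgn-even ∣ i ∣ᵥ even) ⟨
        sgn ∣ P ∣ᵥ * sgn ∣ i ∣ᵥ  ≡⟨ sgn∣S∣ ⟨
        sgn ∣ S ∣ᵥ               ≡⟨ sgnᵏ-≤ k S≤k ⟨
        sgnᵏ k S                 ∎
      sgnᵏ-P≡sgnᵏ-S | no S≰k | no P≰k = trans (sgnᵏ-≰ k P≰k) (sym (sgnᵏ-≰ k S≰k))
      sgnᵏ-P≡sgnᵏ-S | no S≰k | yes P≤k with odd⊎even ∣ P ∣ᵥ
      ...   | inj₁ odd  = ⊥-elim (¬init (odd , P≤k , S≰k ∘ S≤ᵏ))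
      ...   | inj₂ even = trans (trans (sgnᵏ-≤ k P≤k) (sgn-even ∣ P ∣ᵥ even)) (sym (sgnᵏ-≰ k S≰k))

  -- Blocks: the refinements of a single column

  -- suppBeforeᵇ u w: u vanishes strictly after the first nonzero entry of w, i.e. max supp u ≤ min supp w.
  suppBeforeᵇ : ∀ {ℓ} → Vec ℕ ℓ → Vec ℕ ℓ → Bool
  suppBeforeᵇ []      []      = true
  suppBeforeᵇ (_ ∷ u) (y ∷ w) = (isZeroᵇ u ∨ (y ℕ.≡ᵇ 0)) ∧ suppBeforeᵇ u w

  and-++ : ∀ xs ys → and (xs ++ ys) ≡ and xs ∧ and ys
  and-++ []       ys = refl
  and-++ (x ∷ xs) ys = trans (cong (x ∧_) (and-++ xs ys)) (sym (Boolₚ.∧-assoc x _ _))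

  and-map-true : {A : Set} (f : A → Bool) → (∀ x → f x ≡ true) → ∀ xs → and (map f xs) ≡ true
  and-map-true f f≡true []       = refl
  and-map-true f f≡true (x ∷ xs) rewrite f≡true x = and-map-true f f≡true xs

  and-concatMap-∷ : {A : Set} (f : A → Bool) (g : A → List Bool) (xs : List A) →
    and (concatMap (λ x → f x ∷ g x) xs) ≡ and (map f xs) ∧ and (concatMap g xs)
  and-concatMap-∷ f g []       = refl
  and-concatMap-∷ f g (x ∷ xs) = begin
    f x ∧ and (g x ++ concatMap (λ x → f x ∷ g x) xs)
      ≡⟨ cong (f x ∧_) (trans (and-++ (g x) _) (cong (and (g x) ∧_) (and-concatMap-∷ f g xs))) ⟩
    f x ∧ (and (g x) ∧ (and (map f xs) ∧ and (concatMap g xs)))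
      ≡⟨ rearrange (f x) (and (g x)) (and (map f xs)) _ ⟩
    (f x ∧ and (map f xs)) ∧ (and (g x) ∧ and (concatMap g xs))
      ≡⟨ cong ((f x ∧ and (map f xs)) ∧_) (and-++ (g x) (concatMap g xs)) ⟨
    (f x ∧ and (map f xs)) ∧ and (g x ++ concatMap g xs) ∎
    where
    rearrange : ∀ a b c d → a ∧ (b ∧ (c ∧ d)) ≡ (a ∧ c) ∧ (b ∧ d)
    rearrange true  true  c d = refl
    rearrange true  false c d = sym (Boolₚ.∧-zeroʳ c)
    rearrange false _     _ _ = refl

  map-allFin-suc : ∀ {A : Set} {ℓ} (f : Fin (suc ℓ) → A) → map f (allFin (suc ℓ)) ≡ f zero ∷ map (f ∘ suc) (allFin ℓ)
  map-allFin-suc f = cong (f zero ∷_) (trans (Listₚ.map-tabulate suc f) (sym (Listₚ.map-tabulate id (f ∘ suc))))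

  and-map-not-nzAt : ∀ {ℓ} (u : Vec ℕ ℓ) (B : Bool) → and (map (λ a → not (nzAt u a ∧ B)) (allFin ℓ)) ≡ isZeroᵇ u ∨ not B
  and-map-not-nzAt []      B = refl
  and-map-not-nzAt (z ∷ u) B = begin
    and (map (λ a → not (nzAt (z ∷ u) a ∧ B)) (allFin _))
      ≡⟨ cong and (map-allFin-suc (λ a → not (nzAt (z ∷ u) a ∧ B))) ⟩
    not (not (z ℕ.≡ᵇ 0) ∧ B) ∧ and (map (λ a → not (nzAt u a ∧ B)) (allFin _))
      ≡⟨ cong (not (not (z ℕ.≡ᵇ 0) ∧ B) ∧_) (and-map-not-nzAt u B) ⟩
    not (not (z ℕ.≡ᵇ 0) ∧ B) ∧ (isZeroᵇ u ∨ not B)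
      ≡⟨ head-case z B ⟩
    isZeroᵇ (z ∷ u) ∨ not B ∎
    where
    head-case : ∀ z B → not (not (z ℕ.≡ᵇ 0) ∧ B) ∧ (isZeroᵇ u ∨ not B) ≡ isZeroᵇ (z ∷ u) ∨ not B
    head-case zero    B     = refl
    head-case (suc _) true  = refl
    head-case (suc _) false = Boolₚ.∨-zeroʳ (isZeroᵇ u)

  suppOrdᵇ≡suppBeforeᵇ : ∀ {ℓ} (u w : Vec ℕ ℓ) → suppOrdᵇ u w ≡ suppBeforeᵇ u w
  suppOrdᵇ≡suppBeforeᵇ []      []      = refl
  suppOrdᵇ≡suppBeforeᵇ {suc ℓ} (x ∷ u) (y ∷ w) = begin
    and (concatMap row (allFin (suc ℓ)))
      ≡⟨ cong (and ∘ List.concat) (map-allFin-suc row) ⟩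
    and (row zero ++ concatMap (row ∘ suc) (allFin ℓ))
      ≡⟨ and-++ (row zero) _ ⟩
    and (row zero) ∧ and (concatMap (row ∘ suc) (allFin ℓ))
      ≡⟨ cong₂ _∧_ (and-map-true (c zero) (λ b → cong not (first-row b)) (allFin (suc ℓ)))
                   (cong (and ∘ List.concat) (Listₚ.map-cong (λ a → map-allFin-suc (c (suc a))) (allFin ℓ))) ⟩
    and (concatMap (λ a → c (suc a) zero ∷ map (c (suc a) ∘ suc) (allFin ℓ)) (allFin ℓ))
      ≡⟨ and-concatMap-∷ (λ a → c (suc a) zero) (λ a → map (c (suc a) ∘ suc) (allFin ℓ)) (allFin ℓ) ⟩
    and (map (λ a → c (suc a) zero) (allFin ℓ)) ∧ suppOrdᵇ u w
      ≡⟨ cong₂ _∧_ (trans (and-map-not-nzAt u (not (y ℕ.≡ᵇ 0) ∧ true)) (first-column y)) (suppOrdᵇ≡suppBeforeᵇ u w) ⟩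
    (isZeroᵇ u ∨ (y ℕ.≡ᵇ 0)) ∧ suppBeforeᵇ u w ∎
    where
    c : Fin (suc ℓ) → Fin (suc ℓ) → Bool
    c a b = not (nzAt (x ∷ u) a ∧ nzAt (y ∷ w) b ∧ (toℕ b <ᵇ toℕ a))
    row : Fin (suc ℓ) → List Bool
    row a = map (c a) (allFin (suc ℓ))
    first-row : ∀ b → nzAt (x ∷ u) zero ∧ nzAt (y ∷ w) b ∧ false ≡ false
    first-row b = trans (cong (nzAt (x ∷ u) zero ∧_) (Boolₚ.∧-zeroʳ (nzAt (y ∷ w) b))) (Boolₚ.∧-zeroʳ _)
    first-column : ∀ y → isZeroᵇ u ∨ not (not (y ℕ.≡ᵇ 0) ∧ true) ≡ isZeroᵇ u ∨ (y ℕ.≡ᵇ 0)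
    first-column zero    = refl
    first-column (suc _) = refl

  suppBeforeᵇ-+ᵥ : ∀ {ℓ} (u x y : Vec ℕ ℓ) → suppBeforeᵇ u (x +ᵥ y) ≡ suppBeforeᵇ u x ∧ suppBeforeᵇ u y
  suppBeforeᵇ-+ᵥ []      []      []      = refl
  suppBeforeᵇ-+ᵥ (_ ∷ u) (b ∷ x) (c ∷ y) rewrite suppBeforeᵇ-+ᵥ u x y =
    head-case (isZeroᵇ u) b c (suppBeforeᵇ u x) (suppBeforeᵇ u y)
    where
    head-case : ∀ z b c p q →
      (z ∨ (b ℕ.+ c ℕ.≡ᵇ 0)) ∧ (p ∧ q) ≡ ((z ∨ (b ℕ.≡ᵇ 0)) ∧ p) ∧ ((z ∨ (c ℕ.≡ᵇ 0)) ∧ q)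
    head-case true  b       c       p     q = refl
    head-case false zero    zero    p     q = refl
    head-case false zero    (suc c) false q = refl
    head-case false zero    (suc c) true  q = refl
    head-case false (suc b) c       p     q = refl

  suppBeforeᵇ-zeroVʳ : ∀ {ℓ} (u : Vec ℕ ℓ) → suppBeforeᵇ u zeroV ≡ true
  suppBeforeᵇ-zeroVʳ []      = refl
  suppBeforeᵇ-zeroVʳ (_ ∷ u) rewrite suppBeforeᵇ-zeroVʳ u = trans (Boolₚ.∧-identityʳ _) (Boolₚ.∨-zeroʳ (isZeroᵇ u))

  suppBeforeᵇ-zeroVˡ : ∀ {ℓ} (w : Vec ℕ ℓ) → suppBeforeᵇ zeroV w ≡ true
  suppBeforeᵇ-zeroVˡ []              = refl
  suppBeforeᵇ-zeroVˡ {suc ℓ} (_ ∷ w) rewrite isZeroᵇ-zeroV {ℓ} = suppBeforeᵇ-zeroVˡ w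

  and-map-suppOrdᵇ : ∀ {ℓ} (u : Vec ℕ ℓ) (B : VC ℓ) → and (map (suppOrdᵇ u) B) ≡ suppBeforeᵇ u (ΣI B)
  and-map-suppOrdᵇ u []      = sym (suppBeforeᵇ-zeroVʳ u)
  and-map-suppOrdᵇ u (b ∷ B) =
    trans (cong₂ _∧_ (suppOrdᵇ≡suppBeforeᵇ u b) (and-map-suppOrdᵇ u B)) (sym (suppBeforeᵇ-+ᵥ u b (ΣI B)))

  All-cartesianProductWith-∷ : ∀ {ℓ} {P : Vec ℕ (suc ℓ) → Set} (xs : List ℕ) (ys : List (Vec ℕ ℓ)) →
    All (λ x → All (λ w → P (x ∷ w)) ys) xs → All P (cartesianProductWith _∷_ xs ys)
  All-cartesianProductWith-∷ []       ys []         = []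
  All-cartesianProductWith-∷ (x ∷ xs) ys (pw ∷ pws) = Allₚ.++⁺ (Allₚ.map⁺ pw) (All-cartesianProductWith-∷ xs ys pws)

  ∑-cartesianProductWith-∷ : ∀ {ℓ} (f : Vec ℕ (suc ℓ) → ℤ) (xs : List ℕ) (ys : List (Vec ℕ ℓ)) →
    ∑ f (cartesianProductWith _∷_ xs ys) ≡ ∑ (λ x → ∑ (λ w → f (x ∷ w)) ys) xs
  ∑-cartesianProductWith-∷ f []       ys = refl
  ∑-cartesianProductWith-∷ f (x ∷ xs) ys =
    trans (∑-++ f (map (x ∷_) ys) _) (cong₂ _+_ (∑-map f (x ∷_) ys) (∑-cartesianProductWith-∷ f xs ys))

  below-≤ᵥ : ∀ {ℓ} (v : Vec ℕ ℓ) → All (_≤ᵥ v) (below v)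
  below-≤ᵥ []      = [] ∷ []
  below-≤ᵥ (a ∷ v) = All-cartesianProductWith-∷ (upTo (suc a)) (below v)
    (All.map (λ x<1+a → All.map (ℕₚ.≤-pred x<1+a ∷_) (below-≤ᵥ v)) (Allₚ.all-upTo (suc a)))

  +ᵥ-∸ᵥ : ∀ {ℓ} {u v : Vec ℕ ℓ} → u ≤ᵥ v → u +ᵥ (v ∸ᵥ u) ≡ v
  +ᵥ-∸ᵥ []         = refl
  +ᵥ-∸ᵥ (a≤b ∷ ps) = cong₂ _∷_ (ℕₚ.m+[n∸m]≡n a≤b) (+ᵥ-∸ᵥ ps)

  module _ {ℓ : ℕ} where

    compsF-zero : ∀ n (v : Vec ℕ ℓ) → isZeroᵇ v ≡ true → compsF n v ≡ [] ∷ []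
    compsF-zero zero    v e with isZeroᵇ v
    ... | true = refl
    compsF-zero (suc n) v e with isZeroᵇ v
    ... | true = refl

    compsF-suc : ∀ n (v : Vec ℕ ℓ) → isZeroᵇ v ≡ false →
      compsF (suc n) v ≡ concatMap (λ u → map (u ∷_) (compsF n (v ∸ᵥ u))) (filterᵇ (not ∘ isZeroᵇ) (below v))
    compsF-suc n v e with isZeroᵇ v
    ... | false = refl

    compsF-ΣI : ∀ n (v : Vec ℕ ℓ) → All (λ B → ΣI B ≡ v) (compsF n v)
    compsF-ΣI n       v with isZeroᵇ v in e
    compsF-ΣI n       v | true  = sym (isZeroᵇ⇒≡zeroV v e) ∷ []
    compsF-ΣI zero    v | false = []
    compsF-ΣI (suc n) v | false = Allₚ.concat⁺ (Allₚ.map⁺ (Allₚ.filter⁺ (T? ∘ (not ∘ isZeroᵇ))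
      (All.map (λ {u} u≤v → Allₚ.map⁺ (All.map (λ ΣB≡ → trans (cong (u +ᵥ_) ΣB≡) (+ᵥ-∸ᵥ u≤v))
                                                  (compsF-ΣI n (v ∸ᵥ u))))
               (below-≤ᵥ v))))

    compsF-nonEmpty : ∀ n (v : Vec ℕ ℓ) → isZeroᵇ v ≡ false → All NonEmpty (compsF n v)
    compsF-nonEmpty zero    v e with isZeroᵇ v
    ... | false = []
    compsF-nonEmpty (suc n) v e rewrite compsF-suc n v e =
      Allₚ.concat⁺ (Allₚ.map⁺ (All.universal (λ u → map-∷-nonEmpty u (compsF n (v ∸ᵥ u))) (filterᵇ (not ∘ isZeroᵇ) (below v))))

  blocksF : ∀ {ℓ} → ℕ → Vec ℕ ℓ → List (VC ℓ)
  blocksF n v = filterᵇ suppChainᵇ (compsF n v)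

  module _ {ℓ : ℕ} where

    blocksF-zero : ∀ n (v : Vec ℕ ℓ) → isZeroᵇ v ≡ true → blocksF n v ≡ [] ∷ []
    blocksF-zero n v e rewrite compsF-zero n v e = refl

    blocksF-ΣI : ∀ n (v : Vec ℕ ℓ) → All (λ B → ΣI B ≡ v) (blocksF n v)
    blocksF-ΣI n v = Allₚ.filter⁺ (T? ∘ suppChainᵇ) (compsF-ΣI n v)

    blocksF-nonEmpty : ∀ n (v : Vec ℕ ℓ) → isZeroᵇ v ≡ false → All NonEmpty (blocksF n v)
    blocksF-nonEmpty n v e = Allₚ.filter⁺ (T? ∘ suppChainᵇ) (compsF-nonEmpty n v e)

  if-∧ : ∀ a b (x : ℤ) → (if a then (if b then x else + 0) else + 0) ≡ (if a ∧ b then x else + 0)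
  if-∧ true  b x = refl
  if-∧ false b x = refl

  -- The u ≤ v with suppBeforeᵇ u (v ∸ᵥ u) are the prefixes of v read as the word e₀^v₀ e₁^v₁ ⋯,
  -- so u ranges over a chain 0 = u₀ < u₁ < ⋯ < u_|v| = v of steps u_{t+1} = u_t + leadCoord (v ∸ᵥ u_t).
  ∑prefixes : ∀ {ℓ} → Vec ℕ ℓ → (Vec ℕ ℓ → Vec ℕ ℓ → ℤ) → ℤ
  ∑prefixes v G = ∑ (λ u → if suppBeforeᵇ u (v ∸ᵥ u) then G u (v ∸ᵥ u) else + 0) (below v)

  ∑prefixes⁺ : ∀ {ℓ} → Vec ℕ ℓ → (Vec ℕ ℓ → Vec ℕ ℓ → ℤ) → ℤ
  ∑prefixes⁺ v G = ∑ (λ u → if not (isZeroᵇ u) ∧ suppBeforeᵇ u (v ∸ᵥ u) then G u (v ∸ᵥ u) else + 0) (below v)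

  ∑blocksF-suc : ∀ {ℓ} n (v : Vec ℕ ℓ) (φ : VC ℓ → ℤ) → isZeroᵇ v ≡ false →
    ∑ φ (blocksF (suc n) v) ≡ ∑prefixes⁺ v (λ u r → ∑ (φ ∘ (u ∷_)) (blocksF n r))
  ∑blocksF-suc {ℓ} n v φ v≢0 = begin
    ∑ φ (blocksF (suc n) v)
      ≡⟨ ∑-filterᵇ φ suppChainᵇ (compsF (suc n) v) ⟩
    ∑ ψ (compsF (suc n) v)
      ≡⟨ cong (∑ ψ) (compsF-suc n v v≢0) ⟩
    ∑ ψ (concatMap (λ u → map (u ∷_) (compsF n (v ∸ᵥ u))) (filterᵇ (not ∘ isZeroᵇ) (below v)))
      ≡⟨ ∑-concatMap ψ _ (filterᵇ (not ∘ isZeroᵇ) (below v)) ⟩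
    ∑ (λ u → ∑ ψ (map (u ∷_) (compsF n (v ∸ᵥ u)))) (filterᵇ (not ∘ isZeroᵇ) (below v))
      ≡⟨ ∑-filterᵇ _ (not ∘ isZeroᵇ) (below v) ⟩
    ∑ (λ u → if not (isZeroᵇ u) then ∑ ψ (map (u ∷_) (compsF n (v ∸ᵥ u))) else + 0) (below v)
      ≡⟨ ∑-cong (λ u → trans (cong (λ x → if not (isZeroᵇ u) then x else + 0) (first-column u (v ∸ᵥ u)))
                             (if-∧ (not (isZeroᵇ u)) _ _)) (below v) ⟩
    ∑prefixes⁺ v (λ u r → ∑ (φ ∘ (u ∷_)) (blocksF n r)) ∎
    where
    ψ : VC ℓ → ℤ
    ψ B = if suppChainᵇ B then φ B else + 0
    first-column : ∀ u r → ∑ ψ (map (u ∷_) (compsF n r))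
                           ≡ (if suppBeforeᵇ u r then ∑ (φ ∘ (u ∷_)) (blocksF n r) else + 0)
    first-column u r = begin
      ∑ ψ (map (u ∷_) (compsF n r))
        ≡⟨ ∑-map ψ (u ∷_) (compsF n r) ⟩
      ∑ (ψ ∘ (u ∷_)) (compsF n r)
        ≡⟨ ∑-congᴬ (All.map (λ {B} ΣB≡r → chain B ΣB≡r) (compsF-ΣI n r)) ⟩
      ∑ (λ B → if suppBeforeᵇ u r then (if suppChainᵇ B then φ (u ∷ B) else + 0) else + 0) (compsF n r)
        ≡⟨ ∑-if (suppBeforeᵇ u r) _ (compsF n r) ⟩
      (if suppBeforeᵇ u r then ∑ (λ B → if suppChainᵇ B then φ (u ∷ B) else + 0) (compsF n r) else + 0)
        ≡⟨ cong (λ x → if suppBeforeᵇ u r then x else + 0) (∑-filterᵇ (φ ∘ (u ∷_)) suppChainᵇ (compsF n r)) ⟨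
      (if suppBeforeᵇ u r then ∑ (φ ∘ (u ∷_)) (blocksF n r) else + 0) ∎
      where
      chain : ∀ B → ΣI B ≡ r → ψ (u ∷ B) ≡ (if suppBeforeᵇ u r then (if suppChainᵇ B then φ (u ∷ B) else + 0) else + 0)
      chain B ΣB≡r = trans
        (cong (λ b → if b ∧ suppChainᵇ B then φ (u ∷ B) else + 0) (trans (and-map-suppOrdᵇ u B) (cong (suppBeforeᵇ u) ΣB≡r)))
        (sym (if-∧ (suppBeforeᵇ u r) (suppChainᵇ B) _))

  ∑-below-isZeroᵇ : ∀ {ℓ} (v : Vec ℕ ℓ) (K : Vec ℕ ℓ → ℤ) →
    ∑ (λ u → if isZeroᵇ u then K u else + 0) (below v) ≡ K zeroV
  ∑-below-isZeroᵇ []      K = ℤₚ.+-identityʳ _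
  ∑-below-isZeroᵇ (a ∷ v) K = begin
    ∑ term (cartesianProductWith _∷_ (upTo (suc a)) (below v))
      ≡⟨ ∑-cartesianProductWith-∷ term (upTo (suc a)) (below v) ⟩
    ∑ (λ w → term (0 ∷ w)) (below v) + ∑ (λ x → ∑ (λ w → term (x ∷ w)) (below v)) (List.applyUpTo suc a)
      ≡⟨ cong₂ _+_ (∑-below-isZeroᵇ v (K ∘ (0 ∷_))) (∑-vanishᴬ (Allₚ.applyUpTo⁺₂ suc a (λ _ → ∑-zero (below v)))) ⟩
    K zeroV + + 0
      ≡⟨ ℤₚ.+-identityʳ _ ⟩
    K zeroV ∎
    where
    term : Vec ℕ _ → ℤ
    term u = if isZeroᵇ u then K u else + 0

  module _ {ℓ : ℕ} (v : Vec ℕ ℓ) where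

    ∑prefixes⁺-cong : (G G′ : Vec ℕ ℓ → Vec ℕ ℓ → ℤ) →
      (∀ u → isZeroᵇ u ≡ false → G u (v ∸ᵥ u) ≡ G′ u (v ∸ᵥ u)) → ∑prefixes⁺ v G ≡ ∑prefixes⁺ v G′
    ∑prefixes⁺-cong G G′ G≗G′ = ∑-cong term (below v)
      where
      term : ∀ u → (if not (isZeroᵇ u) ∧ suppBeforeᵇ u (v ∸ᵥ u) then G u (v ∸ᵥ u) else + 0)
                 ≡ (if not (isZeroᵇ u) ∧ suppBeforeᵇ u (v ∸ᵥ u) then G′ u (v ∸ᵥ u) else + 0)
      term u with isZeroᵇ u in u≡0
      ... | true  = refl
      ... | false = cong (λ x → if suppBeforeᵇ u (v ∸ᵥ u) then x else + 0) (G≗G′ u u≡0)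

    ∑prefixes⁺≡∑prefixes-zeroV : (G : Vec ℕ ℓ → Vec ℕ ℓ → ℤ) → ∑prefixes⁺ v G ≡ ∑prefixes v G - G zeroV v
    ∑prefixes⁺≡∑prefixes-zeroV G = begin
      ∑prefixes⁺ v G
        ≡⟨ ∑-cong split (below v) ⟩
      ∑ (λ u → K u + - (if isZeroᵇ u then K u else + 0)) (below v)
        ≡⟨ ∑-+ K _ (below v) ⟩
      ∑prefixes v G + ∑ (λ u → - (if isZeroᵇ u then K u else + 0)) (below v)
        ≡⟨ cong (_+_ (∑prefixes v G)) (∑-neg _ (below v)) ⟩
      ∑prefixes v G - ∑ (λ u → if isZeroᵇ u then K u else + 0) (below v)
        ≡⟨ cong (λ x → ∑prefixes v G - x) (trans (∑-below-isZeroᵇ v K) K-zeroV) ⟩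
      ∑prefixes v G - G zeroV v ∎
      where
      K : Vec ℕ ℓ → ℤ
      K u = if suppBeforeᵇ u (v ∸ᵥ u) then G u (v ∸ᵥ u) else + 0
      K-zeroV : K zeroV ≡ G zeroV v
      K-zeroV rewrite ∸ᵥ-identityʳ v | suppBeforeᵇ-zeroVˡ v = refl
      split : ∀ u → (if not (isZeroᵇ u) ∧ suppBeforeᵇ u (v ∸ᵥ u) then G u (v ∸ᵥ u) else + 0)
                  ≡ K u + - (if isZeroᵇ u then K u else + 0)
      split u with isZeroᵇ u | suppBeforeᵇ u (v ∸ᵥ u)
      ... | true  | s     = sym (ℤₚ.+-inverseʳ (if s then G u (v ∸ᵥ u) else + 0))
      ... | false | true  = sym (ℤₚ.+-identityʳ _)
      ... | false | false = refl

  ∑prefixes-∷ : ∀ {ℓ} (a : ℕ) (v : Vec ℕ ℓ) (G : Vec ℕ (suc ℓ) → Vec ℕ (suc ℓ) → ℤ) →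
    ∑prefixes (a ∷ v) G ≡ ∑ (λ x → G (x ∷ zeroV) ((a ∸ x) ∷ v)) (upTo a) + ∑prefixes v (λ w r → G (a ∷ w) (0 ∷ r))
  ∑prefixes-∷ a v G = begin
    ∑prefixes (a ∷ v) G
      ≡⟨ ∑-cartesianProductWith-∷ _ (upTo (suc a)) (below v) ⟩
    ∑ row (upTo (suc a))
      ≡⟨ cong (∑ row) (sym (Listₚ.upTo-∷ʳ a)) ⟩
    ∑ row (upTo a ∷ʳ a)
      ≡⟨ ∑-++ row (upTo a) (a ∷ []) ⟩
    ∑ row (upTo a) + (row a + + 0)
      ≡⟨ cong₂ _+_ (∑-congᴬ (All.map (λ {x} → partial-row x) (Allₚ.all-upTo a)))
                   (trans (ℤₚ.+-identityʳ _) (∑-cong full-row (below v))) ⟩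
    ∑ (λ x → G (x ∷ zeroV) ((a ∸ x) ∷ v)) (upTo a) + ∑prefixes v (λ w r → G (a ∷ w) (0 ∷ r)) ∎
    where
    term : ℕ → Vec ℕ _ → ℤ
    term x w = if (isZeroᵇ w ∨ (a ∸ x ℕ.≡ᵇ 0)) ∧ suppBeforeᵇ w (v ∸ᵥ w) then G (x ∷ w) ((a ∸ x) ∷ (v ∸ᵥ w)) else + 0
    row : ℕ → ℤ
    row x = ∑ (term x) (below v)
    partial-row : ∀ x → x ℕ.< a → row x ≡ G (x ∷ zeroV) ((a ∸ x) ∷ v)
    partial-row x x<a = begin
      row x                                          ≡⟨ ∑-cong only-zeroV (below v) ⟩
      ∑ (λ w → if isZeroᵇ w then K w else + 0) (below v) ≡⟨ ∑-below-isZeroᵇ v K ⟩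
      K zeroV                                        ≡⟨ K-zeroV ⟩
      G (x ∷ zeroV) ((a ∸ x) ∷ v)                    ∎
      where
      K : Vec ℕ _ → ℤ
      K w = if suppBeforeᵇ w (v ∸ᵥ w) then G (x ∷ w) ((a ∸ x) ∷ (v ∸ᵥ w)) else + 0
      a∸x≢0 : (a ∸ x ℕ.≡ᵇ 0) ≡ false
      a∸x≢0 with a ∸ x | ℕₚ.m<n⇒0<n∸m x<a
      ... | suc _ | _ = refl
      only-zeroV : ∀ w → term x w ≡ (if isZeroᵇ w then K w else + 0)
      only-zeroV w rewrite a∸x≢0 with isZeroᵇ w
      ... | true  = refl
      ... | false = refl
      K-zeroV : K zeroV ≡ G (x ∷ zeroV) ((a ∸ x) ∷ v)
      K-zeroV rewrite ∸ᵥ-identityʳ v | suppBeforeᵇ-zeroVˡ v = refl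
    full-row : ∀ w → term a w ≡ (if suppBeforeᵇ w (v ∸ᵥ w) then G (a ∷ w) (0 ∷ (v ∸ᵥ w)) else + 0)
    full-row w rewrite ℕₚ.n∸n≡0 a | Boolₚ.∨-zeroʳ (isZeroᵇ w) = refl

  telescopic : ∀ {ℓ} → (Vec ℕ ℓ → ℤ) → (Vec ℕ ℓ → ℤ) → Vec ℕ ℓ → Vec ℕ ℓ → ℤ
  telescopic A h u r = if isZeroᵇ r then A u else h (u +ᵥ leadCoord r) - h u

  ∑prefixes-telescopic : ∀ {ℓ} (v : Vec ℕ ℓ) (A h : Vec ℕ ℓ → ℤ) (G : Vec ℕ ℓ → Vec ℕ ℓ → ℤ) →
    (∀ u r → u +ᵥ r ≡ v → G u r ≡ telescopic A h u r) → ∑prefixes v G ≡ A v + h v - h zeroV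
  ∑prefixes-telescopic []      A h G G≡ = trans (ℤₚ.+-identityʳ _) (trans (G≡ [] [] refl) (add-sub (A []) (h [])))
    where
    add-sub : ∀ p q → p ≡ p + q - q
    add-sub = solve-∀
  ∑prefixes-telescopic (a ∷ v) A h G G≡ = begin
    ∑prefixes (a ∷ v) G
      ≡⟨ ∑prefixes-∷ a v G ⟩
    ∑ (λ x → G (x ∷ zeroV) ((a ∸ x) ∷ v)) (upTo a) + ∑prefixes v (λ w r → G (a ∷ w) (0 ∷ r))
      ≡⟨ cong₂ _+_ (trans (∑-congᴬ (All.map (λ {x} → first-steps x) (Allₚ.all-upTo a))) (∑-upTo-telescope g a))
                   (∑prefixes-telescopic v (A ∘ (a ∷_)) (h ∘ (a ∷_)) (λ w r → G (a ∷ w) (0 ∷ r)) later-steps) ⟩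
    (g a - g 0) + (A (a ∷ v) + h (a ∷ v) - g a)
      ≡⟨ cancel (g a) (g 0) (A (a ∷ v)) (h (a ∷ v)) ⟩
    A (a ∷ v) + h (a ∷ v) - h zeroV ∎
    where
    cancel : ∀ p q s t → (p - q) + (s + t - p) ≡ s + t - q
    cancel = solve-∀
    g : ℕ → ℤ
    g y = h (y ∷ zeroV)
    first-steps : ∀ x → x ℕ.< a → G (x ∷ zeroV) ((a ∸ x) ∷ v) ≡ g (suc x) - g x
    first-steps x x<a with a ∸ x in a∸x | ℕₚ.m<n⇒0<n∸m x<a
    ... | suc m | _ = begin
      G (x ∷ zeroV) (suc m ∷ v)
        ≡⟨ G≡ (x ∷ zeroV) (suc m ∷ v) (cong₂ _∷_ x+1+m≡a (+ᵥ-identityˡ v)) ⟩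
      h (x ℕ.+ 1 ∷ (zeroV +ᵥ zeroV)) - g x
        ≡⟨ cong (λ y → h y - g x) (cong₂ _∷_ (ℕₚ.+-comm x 1) (+ᵥ-identityˡ zeroV)) ⟩
      g (suc x) - g x ∎
      where
      x+1+m≡a : x ℕ.+ suc m ≡ a
      x+1+m≡a = trans (cong (x ℕ.+_) (sym a∸x)) (ℕₚ.m+[n∸m]≡n (ℕₚ.<⇒≤ x<a))
    later-steps : ∀ w r → w +ᵥ r ≡ v → G (a ∷ w) (0 ∷ r) ≡ telescopic (A ∘ (a ∷_)) (h ∘ (a ∷_)) w r
    later-steps w r w+r≡v = trans (G≡ (a ∷ w) (0 ∷ r) (cong₂ _∷_ (ℕₚ.+-identityʳ a) w+r≡v)) head-zero
      where
      head-zero : telescopic A h (a ∷ w) (0 ∷ r) ≡ telescopic (A ∘ (a ∷_)) (h ∘ (a ∷_)) w r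
      head-zero with isZeroᵇ r
      ... | true  = refl
      ... | false = cong (λ y → h (y ∷ (w +ᵥ leadCoord r)) - h (a ∷ w)) (ℕₚ.+-identityʳ a)

  ∑blocksF-telescopic : ∀ {ℓ} n (v : Vec ℕ ℓ) (φ : VC ℓ → ℤ) (h : Vec ℕ ℓ → ℤ) → isZeroᵇ v ≡ false →
    (∀ u r → u +ᵥ r ≡ v → isZeroᵇ u ≡ false → isZeroᵇ r ≡ false →
       ∑ (φ ∘ (u ∷_)) (blocksF n r) ≡ h (u +ᵥ leadCoord r) - h u) →
    ∑ φ (blocksF (suc n) v) ≡ φ (v ∷ []) + h v - h (leadCoord v)
  ∑blocksF-telescopic {ℓ} n v φ h v≢0 step = begin
    ∑ φ (blocksF (suc n) v)
      ≡⟨ ∑blocksF-suc n v φ v≢0 ⟩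
    ∑prefixes⁺ v G
      ≡⟨ ∑prefixes⁺-cong v G G̃ (λ u u≢0 → sym (G̃≡G u (v ∸ᵥ u) u≢0)) ⟩
    ∑prefixes⁺ v G̃
      ≡⟨ ∑prefixes⁺≡∑prefixes-zeroV v G̃ ⟩
    ∑prefixes v G̃ - G̃ zeroV v
      ≡⟨ cong₂ _-_ (∑prefixes-telescopic v A h G̃ G̃-telescopic) G̃-zeroV ⟩
    A v + h v - h zeroV - (h (leadCoord v) - h zeroV)
      ≡⟨ cancel (A v) (h v) (h zeroV) (h (leadCoord v)) ⟩
    A v + h v - h (leadCoord v) ∎
    where
    cancel : ∀ a b c d → a + b - c - (d - c) ≡ a + b - d
    cancel = solve-∀
    A : Vec ℕ ℓ → ℤ
    A u = φ (u ∷ [])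
    G : Vec ℕ ℓ → Vec ℕ ℓ → ℤ
    G u r = ∑ (φ ∘ (u ∷_)) (blocksF n r)
    G-telescopic : ∀ u r → u +ᵥ r ≡ v → isZeroᵇ u ≡ false → G u r ≡ telescopic A h u r
    G-telescopic u r u+r≡v u≢0 = by-cases (isZeroᵇ r) refl
      where
      by-cases : ∀ b → isZeroᵇ r ≡ b → G u r ≡ (if b then A u else h (u +ᵥ leadCoord r) - h u)
      by-cases true  r≡0 = trans (cong (∑ (φ ∘ (u ∷_))) (blocksF-zero n r r≡0)) (ℤₚ.+-identityʳ _)
      by-cases false r≢0 = step u r u+r≡v u≢0 r≢0
    -- G̃ also assigns the telescopic value to the empty first column u = 0, so that the full prefix sum telescopes.
    G̃ : Vec ℕ ℓ → Vec ℕ ℓ → ℤ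
    G̃ u r = if isZeroᵇ u then telescopic A h u r else G u r
    G̃≡G : ∀ u r → isZeroᵇ u ≡ false → G̃ u r ≡ G u r
    G̃≡G u r u≢0 rewrite u≢0 = refl
    G̃-telescopic : ∀ u r → u +ᵥ r ≡ v → G̃ u r ≡ telescopic A h u r
    G̃-telescopic u r u+r≡v with isZeroᵇ u in u≢0
    ... | true  = refl
    ... | false = G-telescopic u r u+r≡v u≢0
    G̃-zeroV : G̃ zeroV v ≡ h (leadCoord v) - h zeroV
    G̃-zeroV rewrite isZeroᵇ-zeroV {ℓ} | v≢0 = cong (λ w → h w - h zeroV) (+ᵥ-identityˡ (leadCoord v))

  ∣∣-remainder-≤ : ∀ {ℓ} {n} {u r v : Vec ℕ ℓ} → u +ᵥ r ≡ v → isZeroᵇ u ≡ false → ∣ v ∣ᵥ ℕ.≤ suc n → ∣ r ∣ᵥ ℕ.≤ n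
  ∣∣-remainder-≤ {u = u} {r} {v} u+r≡v u≢0 ∣v∣≤ = ℕₚ.≤-pred (ℕₚ.≤-trans 1+∣r∣≤∣v∣ ∣v∣≤)
    where
    1+∣r∣≤∣v∣ : suc ∣ r ∣ᵥ ℕ.≤ ∣ v ∣ᵥ
    1+∣r∣≤∣v∣ = ℕₚ.≤-trans (ℕₚ.+-monoˡ-≤ ∣ r ∣ᵥ (isZeroᵇ≡false⇒1≤∣∣ u u≢0))
                           (ℕₚ.≤-reflexive (trans (sym (∣+ᵥ∣ u r)) (cong ∣_∣ᵥ u+r≡v)))

  ∑blocksF-νʰ : ∀ {ℓ} n (v : Vec ℕ ℓ) → ∣ v ∣ᵥ ℕ.≤ n → isZeroᵇ v ≡ false → (h : Vec ℕ ℓ → ℤ) →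
    ∑ (νʰ h) (blocksF n v) ≡ h zeroV - h (leadCoord v)
  ∑blocksF-νʰ zero    v ∣v∣≤0 v≢0 h = ⊥-elim (ℕₚ.<⇒≱ (isZeroᵇ≡false⇒1≤∣∣ v v≢0) ∣v∣≤0)
  ∑blocksF-νʰ (suc n) v ∣v∣≤ v≢0 h = begin
    ∑ (νʰ h) (blocksF (suc n) v)
      ≡⟨ ∑blocksF-telescopic n v (νʰ h) h v≢0 step ⟩
    νʰ h (v ∷ []) + h v - h (leadCoord v)
      ≡⟨ cong (λ x → x + h v - h (leadCoord v)) (trans (νʰ-∷ʳ h [] v) (cong (λ w → + 1 * (h zeroV - h w)) (+ᵥ-identityˡ v))) ⟩
    + 1 * (h zeroV - h v) + h v - h (leadCoord v)
      ≡⟨ cancel (h zeroV) (h v) (h (leadCoord v)) ⟩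
    h zeroV - h (leadCoord v) ∎
    where
    cancel : ∀ a b c → + 1 * (a - b) + b - c ≡ a - c
    cancel = solve-∀
    step : ∀ u r → u +ᵥ r ≡ v → isZeroᵇ u ≡ false → isZeroᵇ r ≡ false →
      ∑ (νʰ h ∘ (u ∷_)) (blocksF n r) ≡ h (u +ᵥ leadCoord r) - h u
    step u r u+r≡v u≢0 r≢0 = begin
      ∑ (νʰ h ∘ (u ∷_)) (blocksF n r)
        ≡⟨ ∑-congᴬ (All.map (νʰ-∷-nonEmpty h u) (blocksF-nonEmpty n r r≢0)) ⟩
      ∑ (λ B → - νʰ (h ∘ (u +ᵥ_)) B) (blocksF n r)
        ≡⟨ ∑-neg (νʰ (h ∘ (u +ᵥ_))) (blocksF n r) ⟩
      - ∑ (νʰ (h ∘ (u +ᵥ_))) (blocksF n r)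
        ≡⟨ cong -_ (∑blocksF-νʰ n r (∣∣-remainder-≤ u+r≡v u≢0 ∣v∣≤) r≢0 (h ∘ (u +ᵥ_))) ⟩
      - (h (u +ᵥ zeroV) - h (u +ᵥ leadCoord r))
        ≡⟨ cong (λ w → - (h w - h (u +ᵥ leadCoord r))) (+ᵥ-identityʳ u) ⟩
      - (h u - h (u +ᵥ leadCoord r))
        ≡⟨ neg-sub (h u) (h (u +ᵥ leadCoord r)) ⟩
      h (u +ᵥ leadCoord r) - h u ∎
      where
      neg-sub : ∀ a b → - (a - b) ≡ b - a
      neg-sub = solve-∀

  δ : ℕ → ℕ → ℤ
  δ m n = if m ℕ.≡ᵇ n then + 1 else + 0

  δ-refl : ∀ m → δ m m ≡ + 1
  δ-refl zero    = refl
  δ-refl (suc m) = δ-refl m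

  δ-+ : ∀ m a b → δ (m ℕ.+ a) (m ℕ.+ b) ≡ δ a b
  δ-+ zero    a b = refl
  δ-+ (suc m) a b = δ-+ m a b

  δ-0-pos : ∀ {n} → 1 ℕ.≤ n → δ 0 n ≡ + 0
  δ-0-pos (s≤s z≤n) = refl

  ∑blocksF-sgn-length : ∀ {ℓ} n (v : Vec ℕ ℓ) → ∣ v ∣ᵥ ℕ.≤ n → isZeroᵇ v ≡ false →
    ∑ (sgn ∘ length) (blocksF n v) ≡ - δ 1 ∣ v ∣ᵥ
  ∑blocksF-sgn-length zero    v ∣v∣≤0 v≢0 = ⊥-elim (ℕₚ.<⇒≱ (isZeroᵇ≡false⇒1≤∣∣ v v≢0) ∣v∣≤0)
  ∑blocksF-sgn-length (suc n) v ∣v∣≤ v≢0 = begin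
    ∑ (sgn ∘ length) (blocksF (suc n) v)
      ≡⟨ ∑blocksF-telescopic n v (sgn ∘ length) full v≢0 step ⟩
    - + 1 + full v - full (leadCoord v)
      ≡⟨ cong₂ (λ x y → - + 1 + x - y) (δ-refl ∣ v ∣ᵥ) (cong (λ m → δ m ∣ v ∣ᵥ) (∣leadCoord∣ v v≢0)) ⟩
    - + 1 + + 1 - δ 1 ∣ v ∣ᵥ
      ≡⟨ cancel (δ 1 ∣ v ∣ᵥ) ⟩
    - δ 1 ∣ v ∣ᵥ ∎
    where
    cancel : ∀ x → - + 1 + + 1 - x ≡ - x
    cancel = solve-∀
    full : Vec ℕ _ → ℤ
    full x = δ ∣ x ∣ᵥ ∣ v ∣ᵥ
    step : ∀ u r → u +ᵥ r ≡ v → isZeroᵇ u ≡ false → isZeroᵇ r ≡ false →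
      ∑ (sgn ∘ length ∘ (u ∷_)) (blocksF n r) ≡ full (u +ᵥ leadCoord r) - full u
    step u r u+r≡v u≢0 r≢0 = begin
      ∑ (λ B → sgn (suc (length B))) (blocksF n r)
        ≡⟨ ∑-cong (sgn-suc ∘ length) (blocksF n r) ⟩
      ∑ (λ B → - sgn (length B)) (blocksF n r)
        ≡⟨ ∑-neg (sgn ∘ length) (blocksF n r) ⟩
      - ∑ (sgn ∘ length) (blocksF n r)
        ≡⟨ cong -_ (∑blocksF-sgn-length n r (∣∣-remainder-≤ u+r≡v u≢0 ∣v∣≤) r≢0) ⟩
      - - δ 1 ∣ r ∣ᵥ
        ≡⟨ ℤₚ.neg-involutive _ ⟩
      δ 1 ∣ r ∣ᵥ
        ≡⟨ ℤₚ.+-identityʳ _ ⟨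
      δ 1 ∣ r ∣ᵥ - + 0
        ≡⟨ cong₂ _-_ (δ-+ ∣ u ∣ᵥ 1 ∣ r ∣ᵥ)
                     (trans (δ-+ ∣ u ∣ᵥ 0 ∣ r ∣ᵥ) (δ-0-pos (isZeroᵇ≡false⇒1≤∣∣ r r≢0))) ⟨
      δ (∣ u ∣ᵥ ℕ.+ 1) (∣ u ∣ᵥ ℕ.+ ∣ r ∣ᵥ) - δ (∣ u ∣ᵥ ℕ.+ 0) (∣ u ∣ᵥ ℕ.+ ∣ r ∣ᵥ)
        ≡⟨ cong₂ (λ a b → δ a (∣ u ∣ᵥ ℕ.+ ∣ r ∣ᵥ) - δ b (∣ u ∣ᵥ ℕ.+ ∣ r ∣ᵥ))
                 ∣u+leadCoord-r∣ (sym (ℕₚ.+-identityʳ ∣ u ∣ᵥ)) ⟨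
      δ ∣ u +ᵥ leadCoord r ∣ᵥ (∣ u ∣ᵥ ℕ.+ ∣ r ∣ᵥ) - δ ∣ u ∣ᵥ (∣ u ∣ᵥ ℕ.+ ∣ r ∣ᵥ)
        ≡⟨ cong (λ c → δ ∣ u +ᵥ leadCoord r ∣ᵥ c - δ ∣ u ∣ᵥ c) ∣v∣ ⟨
      δ ∣ u +ᵥ leadCoord r ∣ᵥ ∣ v ∣ᵥ - δ ∣ u ∣ᵥ ∣ v ∣ᵥ ∎
      where
      ∣u+leadCoord-r∣ : ∣ u +ᵥ leadCoord r ∣ᵥ ≡ ∣ u ∣ᵥ ℕ.+ 1
      ∣u+leadCoord-r∣ = trans (∣+ᵥ∣ u (leadCoord r)) (cong (∣ u ∣ᵥ ℕ.+_) (∣leadCoord∣ r r≢0))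
      ∣v∣ : ∣ v ∣ᵥ ≡ ∣ u ∣ᵥ ℕ.+ ∣ r ∣ᵥ
      ∣v∣ = trans (cong ∣_∣ᵥ (sym u+r≡v)) (∣+ᵥ∣ u r)

  -- ν^k on the fundamental basis

  νʰF : ∀ {ℓ} → (Vec ℕ ℓ → ℤ) → VC ℓ → ℤ
  νʰF h I = ∑ (νʰ h) (refinements I)

  νL-F : ∀ {ℓ} (k : Vec ℕ∞ ℓ) (I : VC ℓ) → νL k (F I) ≡ νʰF (sgnᵏ k) I
  νL-F k I = begin
    νL k (F I)                                    ≡⟨ evalL-∑ (νM k) (F I) ⟩
    ∑ (λ (c , J) → c * νM k J) (F I)              ≡⟨ ∑-map (λ (c , J) → c * νM k J) (λ J → (+ 1 , J)) (refinements I) ⟩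
    ∑ (λ J → + 1 * νM k J) (refinements I)        ≡⟨ ∑-cong (λ J → trans (ℤₚ.*-identityˡ _) (νM≡νʰ k J)) (refinements I) ⟩
    νʰF (sgnᵏ k) I                                ∎

  module _ {ℓ : ℕ} where

    refinements-nonEmpty : (i : Vec ℕ ℓ) (I : VC ℓ) → NonZeroV i → All NonEmpty (refinements (i ∷ I))
    refinements-nonEmpty i I i≢0 = Allₚ.concat⁺ (Allₚ.map⁺
      (All.map (λ {B} B≢[] → Allₚ.map⁺ (All.universal (λ J → ++-nonEmpty B J B≢[]) (refinements I)))
               (blocksF-nonEmpty ∣ i ∣ᵥ i (NonZeroV⇒isZeroᵇ≡false i i≢0))))
      where
      ++-nonEmpty : ∀ (B J : VC ℓ) → NonEmpty B → NonEmpty (B ++ J)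
      ++-nonEmpty (_ ∷ _) J nonEmpty = nonEmpty

    νʰF-cong : {h h′ : Vec ℕ ℓ → ℤ} → (∀ x → h x ≡ h′ x) → ∀ I → νʰF h I ≡ νʰF h′ I
    νʰF-cong h≗h′ I = ∑-cong (νʰ-cong h≗h′) (refinements I)

    νʰF-single : (h : Vec ℕ ℓ → ℤ) (i : Vec ℕ ℓ) → NonZeroV i → νʰF h (i ∷ []) ≡ h zeroV - h (leadCoord i)
    νʰF-single h i i≢0 = begin
      ∑ (νʰ h) (concatMap (λ B → map (B ++_) ([] ∷ [])) (blocks i))
        ≡⟨ ∑-concatMap (νʰ h) (λ B → map (B ++_) ([] ∷ [])) (blocks i) ⟩
      ∑ (λ B → νʰ h (B ++ []) + + 0) (blocks i)
        ≡⟨ ∑-cong (λ B → trans (ℤₚ.+-identityʳ _) (cong (νʰ h) (Listₚ.++-identityʳ B))) (blocks i) ⟩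
      ∑ (νʰ h) (blocks i)
        ≡⟨ ∑blocksF-νʰ ∣ i ∣ᵥ i ℕₚ.≤-refl (NonZeroV⇒isZeroᵇ≡false i i≢0) h ⟩
      h zeroV - h (leadCoord i) ∎

    νʰF-∷-∷ : (h : Vec ℕ ℓ → ℤ) (i j : Vec ℕ ℓ) (I : VC ℓ) → NonZeroV i → NonZeroV j →
      νʰF h (i ∷ j ∷ I) ≡ - δ 1 ∣ i ∣ᵥ * νʰF (h ∘ (i +ᵥ_)) (j ∷ I)
    νʰF-∷-∷ h i j I i≢0 j≢0 = begin
      ∑ (νʰ h) (concatMap (λ B → map (B ++_) (refinements (j ∷ I))) (blocks i))
        ≡⟨ ∑-concatMap (νʰ h) (λ B → map (B ++_) (refinements (j ∷ I))) (blocks i) ⟩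
      ∑ (λ B → ∑ (νʰ h) (map (B ++_) (refinements (j ∷ I)))) (blocks i)
        ≡⟨ ∑-congᴬ (All.map (λ {B} → first-block B) (blocksF-ΣI ∣ i ∣ᵥ i)) ⟩
      ∑ (λ B → sgn (length B) * νʰF (h ∘ (i +ᵥ_)) (j ∷ I)) (blocks i)
        ≡⟨ ∑-*ʳ (νʰF (h ∘ (i +ᵥ_)) (j ∷ I)) (sgn ∘ length) (blocks i) ⟩
      ∑ (sgn ∘ length) (blocks i) * νʰF (h ∘ (i +ᵥ_)) (j ∷ I)
        ≡⟨ cong (_* νʰF (h ∘ (i +ᵥ_)) (j ∷ I))
                (∑blocksF-sgn-length ∣ i ∣ᵥ i ℕₚ.≤-refl (NonZeroV⇒isZeroᵇ≡false i i≢0)) ⟩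
      - δ 1 ∣ i ∣ᵥ * νʰF (h ∘ (i +ᵥ_)) (j ∷ I) ∎
      where
      first-block : ∀ B → ΣI B ≡ i →
        ∑ (νʰ h) (map (B ++_) (refinements (j ∷ I))) ≡ sgn (length B) * νʰF (h ∘ (i +ᵥ_)) (j ∷ I)
      first-block B ΣB≡i = begin
        ∑ (νʰ h) (map (B ++_) (refinements (j ∷ I)))
          ≡⟨ ∑-map (νʰ h) (B ++_) (refinements (j ∷ I)) ⟩
        ∑ (λ J → νʰ h (B ++ J)) (refinements (j ∷ I))
          ≡⟨ ∑-congᴬ (All.map (νʰ-++ h B) (refinements-nonEmpty j I j≢0)) ⟩
        ∑ (λ J → sgn (length B) * νʰ (h ∘ (ΣI B +ᵥ_)) J) (refinements (j ∷ I))
          ≡⟨ ∑-*ˡ (sgn (length B)) (νʰ (h ∘ (ΣI B +ᵥ_))) (refinements (j ∷ I)) ⟩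
        sgn (length B) * νʰF (h ∘ (ΣI B +ᵥ_)) (j ∷ I)
          ≡⟨ cong (λ v → sgn (length B) * νʰF (h ∘ (v +ᵥ_)) (j ∷ I)) ΣB≡i ⟩
        sgn (length B) * νʰF (h ∘ (i +ᵥ_)) (j ∷ I) ∎

    νʰF-∷-∷ʳ : (h : Vec ℕ ℓ → ℤ) (e : Vec ℕ ℓ) (E : VC ℓ) (i : Vec ℕ ℓ) → NonZeroV e → All NonZeroV (E ∷ʳ i) →
      νʰF h (e ∷ E ∷ʳ i) ≡ - δ 1 ∣ e ∣ᵥ * νʰF (h ∘ (e +ᵥ_)) (E ∷ʳ i)
    νʰF-∷-∷ʳ h e []      i e≢0 (i≢0 ∷ _) = νʰF-∷-∷ h e i [] e≢0 i≢0
    νʰF-∷-∷ʳ h e (x ∷ E) i e≢0 (x≢0 ∷ _) = νʰF-∷-∷ h e x (E ∷ʳ i) e≢0 x≢0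

  Unit : ∀ {ℓ} → Vec ℕ ℓ → Set
  Unit v = ∣ v ∣ᵥ ≡ 1

  module _ {ℓ : ℕ} where

    νʰF-units-∷ʳ : (h : Vec ℕ ℓ → ℤ) (E : VC ℓ) (i : Vec ℕ ℓ) → All NonZeroV (E ∷ʳ i) → All Unit E →
      νʰF h (E ∷ʳ i) ≡ sgn (length E) * (h (ΣI E) - h (ΣI E +ᵥ leadCoord i))
    νʰF-units-∷ʳ h []      i (i≢0 ∷ []) [] = begin
      νʰF h (i ∷ [])                             ≡⟨ νʰF-single h i i≢0 ⟩
      h zeroV - h (leadCoord i)                  ≡⟨ cong (λ v → h zeroV - h v) (+ᵥ-identityˡ (leadCoord i)) ⟨
      h zeroV - h (zeroV +ᵥ leadCoord i)         ≡⟨ ℤₚ.*-identityˡ _ ⟨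
      + 1 * (h zeroV - h (zeroV +ᵥ leadCoord i)) ∎
    νʰF-units-∷ʳ h (e ∷ E) i (e≢0 ∷ ≢0s) (∣e∣≡1 ∷ units) = begin
      νʰF h (e ∷ E ∷ʳ i)
        ≡⟨ νʰF-∷-∷ʳ h e E i e≢0 ≢0s ⟩
      - δ 1 ∣ e ∣ᵥ * νʰF (h ∘ (e +ᵥ_)) (E ∷ʳ i)
        ≡⟨ cong₂ (λ m x → - δ 1 m * x) ∣e∣≡1 (νʰF-units-∷ʳ (h ∘ (e +ᵥ_)) E i ≢0s units) ⟩
      - + 1 * (sgn (length E) * (h (e +ᵥ ΣI E) - h (e +ᵥ (ΣI E +ᵥ leadCoord i))))
        ≡⟨ cong (λ v → - + 1 * (sgn (length E) * (h (e +ᵥ ΣI E) - h v))) (+ᵥ-assoc e (ΣI E) (leadCoord i)) ⟨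
      - + 1 * (sgn (length E) * (h (e +ᵥ ΣI E) - h ((e +ᵥ ΣI E) +ᵥ leadCoord i)))
        ≡⟨ neg-assoc (sgn (length E)) _ ⟩
      - sgn (length E) * (h (e +ᵥ ΣI E) - h ((e +ᵥ ΣI E) +ᵥ leadCoord i))
        ≡⟨ cong (_* (h (e +ᵥ ΣI E) - h ((e +ᵥ ΣI E) +ᵥ leadCoord i))) (sgn-suc (length E)) ⟨
      sgn (suc (length E)) * (h (e +ᵥ ΣI E) - h ((e +ᵥ ΣI E) +ᵥ leadCoord i)) ∎
      where
      neg-assoc : ∀ s d → - + 1 * (s * d) ≡ - s * d
      neg-assoc = solve-∀

    νʰF-nonunit-∷ʳ : (h : Vec ℕ ℓ → ℤ) (E : VC ℓ) (i : Vec ℕ ℓ) → All NonZeroV (E ∷ʳ i) → ¬ All Unit E →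
      νʰF h (E ∷ʳ i) ≡ + 0
    νʰF-nonunit-∷ʳ h []      i _            ¬units = ⊥-elim (¬units [])
    νʰF-nonunit-∷ʳ h (e ∷ E) i (e≢0 ∷ ≢0s) ¬units = trans (νʰF-∷-∷ʳ h e E i e≢0 ≢0s) (by-cases (∣ e ∣ᵥ ℕₚ.≟ 1))
      where
      by-cases : Dec (Unit e) → - δ 1 ∣ e ∣ᵥ * νʰF (h ∘ (e +ᵥ_)) (E ∷ʳ i) ≡ + 0
      by-cases (yes unit)   = trans (cong (- δ 1 ∣ e ∣ᵥ *_) (νʰF-nonunit-∷ʳ (h ∘ (e +ᵥ_)) E i ≢0s (¬units ∘ (unit ∷_))))
                                    (ℤₚ.*-zeroʳ (- δ 1 ∣ e ∣ᵥ))
      by-cases (no nonunit) = cong (λ x → - x * νʰF (h ∘ (e +ᵥ_)) (E ∷ʳ i)) (δ-≢ nonunit)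
        where
        δ-≢ : ∀ {m} → ¬ m ≡ 1 → δ 1 m ≡ + 0
        δ-≢ {zero}        _   = refl
        δ-≢ {suc zero}    m≢1 = ⊥-elim (m≢1 refl)
        δ-≢ {suc (suc _)} _   = refl

  IsCoord : ∀ {ℓ} → Vec ℕ ℓ → Set
  IsCoord v = ∃[ j ] v ≡ coord j

  coord-zero : ∀ {ℓ} → coord {suc ℓ} zero ≡ 1 ∷ zeroV
  coord-zero {ℓ} = cong (1 ∷_) (tabulate-zero ℓ)
    where
    tabulate-zero : ∀ n → tabulate {n = n} (λ _ → 0) ≡ replicate n 0
    tabulate-zero zero    = refl
    tabulate-zero (suc n) = cong (0 ∷_) (tabulate-zero n)

  ∣coord∣ : ∀ {ℓ} (j : Fin ℓ) → Unit (coord j)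
  ∣coord∣ {suc ℓ} zero    = trans (cong ∣_∣ᵥ (coord-zero {ℓ})) (cong suc (∣zeroV∣ {ℓ}))
  ∣coord∣ {suc ℓ} (suc j) = ∣coord∣ j

  Unit⇒≡1∷zeroV : ∀ {ℓ} {a : ℕ} (v : Vec ℕ ℓ) → Unit (suc a ∷ v) → a ≡ 0 × v ≡ zeroV
  Unit⇒≡1∷zeroV {a = zero} v ∣v∣≡0 = refl , isZeroᵇ⇒≡zeroV v (∣∣≡0⇒isZeroᵇ v (ℕₚ.suc-injective ∣v∣≡0))

  Unit⇒IsCoord : ∀ {ℓ} (v : Vec ℕ ℓ) → Unit v → IsCoord v
  Unit⇒IsCoord (zero  ∷ v) unit with Unit⇒IsCoord v unit
  ... | j , v≡ = suc j , cong (0 ∷_) v≡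
  Unit⇒IsCoord (suc _ ∷ v) unit with Unit⇒≡1∷zeroV v unit
  ... | refl , refl = zero , sym coord-zero

  leadCoord-Unit : ∀ {ℓ} (v : Vec ℕ ℓ) → Unit v → leadCoord v ≡ v
  leadCoord-Unit (zero  ∷ v) unit = cong (0 ∷_) (leadCoord-Unit v unit)
  leadCoord-Unit (suc _ ∷ v) unit with Unit⇒≡1∷zeroV v unit
  ... | refl , refl = refl

  length-Units : ∀ {ℓ} (E : VC ℓ) → All Unit E → length E ≡ ∣ E ∣c
  length-Units {ℓ} []      []             = sym (∣zeroV∣ {ℓ})
  length-Units     (e ∷ E) (∣e∣≡1 ∷ units) =
    trans (cong suc (length-Units E units)) (sym (trans (∣+ᵥ∣ e (ΣI E)) (cong (ℕ._+ ∣ E ∣c) ∣e∣≡1)))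

  F-condition : ∀ {ℓ} → Vec ℕ∞ ℓ → VC ℓ → VC ℓ → Vec ℕ ℓ → Set
  F-condition k I E i =
    ΣI I ≤ᵏ k ⊎ (Odd ∣ E ∣c × ΣI E ≤ᵏ k) ⊎ (Even ∣ E ∣c × 1 ℕ.< ∣ i ∣ᵥ × (ΣI E +ᵥ leadCoord i) ≤ᵏ k)

  F-good : ∀ {ℓ} → Vec ℕ∞ ℓ → VC ℓ → Set
  F-good k I = ∃[ E ] ∃[ i ] (I ≡ E ∷ʳ i × All IsCoord E × F-condition k I E i)

  module _ {ℓ : ℕ} (k : Vec ℕ∞ ℓ) (E : VC ℓ) (i : Vec ℕ ℓ) (≢0s : All NonZeroV (E ∷ʳ i)) (units : All Unit E) where

    private
      P Q : Vec ℕ ℓ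
      P = ΣI E
      Q = ΣI E +ᵥ leadCoord i

      i≢0 : isZeroᵇ i ≡ false
      i≢0 = NonZeroV⇒isZeroᵇ≡false i (proj₂ (Allₚ.∷ʳ⁻ ≢0s))

      P≤ᵥQ : P ≤ᵥ Q
      P≤ᵥQ = ≤ᵥ-+ᵥʳ P (leadCoord i)

      sgn∣Q∣ : sgn ∣ Q ∣ᵥ ≡ - sgn ∣ P ∣ᵥ
      sgn∣Q∣ = begin
        sgn ∣ Q ∣ᵥ                 ≡⟨ cong sgn (∣+ᵥ∣ P (leadCoord i)) ⟩
        sgn (∣ P ∣ᵥ ℕ.+ ∣ leadCoord i ∣ᵥ) ≡⟨ cong (λ n → sgn (∣ P ∣ᵥ ℕ.+ n)) (∣leadCoord∣ i i≢0) ⟩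
        sgn (∣ P ∣ᵥ ℕ.+ 1)         ≡⟨ cong sgn (ℕₚ.+-comm ∣ P ∣ᵥ 1) ⟩
        sgn (suc ∣ P ∣ᵥ)           ≡⟨ sgn-suc ∣ P ∣ᵥ ⟩
        - sgn ∣ P ∣ᵥ               ∎

      value : νL k (F (E ∷ʳ i)) ≡ sgn ∣ P ∣ᵥ * (sgnᵏ k P - sgnᵏ k Q)
      value = begin
        νL k (F (E ∷ʳ i))                                  ≡⟨ νL-F k (E ∷ʳ i) ⟩
        νʰF (sgnᵏ k) (E ∷ʳ i)                              ≡⟨ νʰF-units-∷ʳ (sgnᵏ k) E i ≢0s units ⟩
        sgn (length E) * (sgnᵏ k P - sgnᵏ k Q)             ≡⟨ cong (λ n → sgn n * (sgnᵏ k P - sgnᵏ k Q)) (length-Units E units) ⟩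
        sgn ∣ P ∣ᵥ * (sgnᵏ k P - sgnᵏ k Q)                 ∎

      Q≤ᵏ⇒2 : Q ≤ᵏ k → νL k (F (E ∷ʳ i)) ≡ + 2
      Q≤ᵏ⇒2 Q≤k = begin
        νL k (F (E ∷ʳ i))
          ≡⟨ value ⟩
        sgn ∣ P ∣ᵥ * (sgnᵏ k P - sgnᵏ k Q)
          ≡⟨ cong₂ (λ x y → sgn ∣ P ∣ᵥ * (x - y)) (sgnᵏ-≤ k (≤ᵥ-≤ᵏ-trans P≤ᵥQ Q≤k)) (trans (sgnᵏ-≤ k Q≤k) sgn∣Q∣) ⟩
        sgn ∣ P ∣ᵥ * (sgn ∣ P ∣ᵥ - - sgn ∣ P ∣ᵥ)
          ≡⟨ double (sgn ∣ P ∣ᵥ) ⟩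
        + 2 * (sgn ∣ P ∣ᵥ * sgn ∣ P ∣ᵥ)
          ≡⟨ cong (+ 2 *_) (sgn-*-self ∣ P ∣ᵥ) ⟩
        + 2 ∎
        where
        double : ∀ s → s * (s - - s) ≡ + 2 * (s * s)
        double = solve-∀

      P≤ᵏ-Q≰ᵏ : P ≤ᵏ k → ¬ Q ≤ᵏ k → νL k (F (E ∷ʳ i)) ≡ sgn ∣ P ∣ᵥ * (sgn ∣ P ∣ᵥ - + 1)
      P≤ᵏ-Q≰ᵏ P≤k Q≰k = trans value (cong₂ (λ x y → sgn ∣ P ∣ᵥ * (x - y)) (sgnᵏ-≤ k P≤k) (sgnᵏ-≰ k Q≰k))

      P≰ᵏ⇒0 : ¬ P ≤ᵏ k → νL k (F (E ∷ʳ i)) ≡ + 0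
      P≰ᵏ⇒0 P≰k = begin
        νL k (F (E ∷ʳ i))                   ≡⟨ value ⟩
        sgn ∣ P ∣ᵥ * (sgnᵏ k P - sgnᵏ k Q)
          ≡⟨ cong₂ (λ x y → sgn ∣ P ∣ᵥ * (x - y)) (sgnᵏ-≰ k P≰k) (sgnᵏ-≰ k (P≰k ∘ ≤ᵥ-≤ᵏ-trans P≤ᵥQ)) ⟩
        sgn ∣ P ∣ᵥ * (+ 1 - + 1)            ≡⟨ ℤₚ.*-zeroʳ (sgn ∣ P ∣ᵥ) ⟩
        + 0                                 ∎

    νL-F-condition : F-condition k (E ∷ʳ i) E i → νL k (F (E ∷ʳ i)) ≡ + 2
    νL-F-condition (inj₁ S≤k) =
      Q≤ᵏ⇒2 (≤ᵥ-≤ᵏ-trans (+ᵥ-monoʳ-≤ᵥ P (leadCoord-≤ᵥ i)) (subst (_≤ᵏ k) (ΣI-∷ʳ E i) S≤k))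
    νL-F-condition (inj₂ (inj₁ (odd , P≤k))) with ≤ᵏ? Q k
    ... | yes Q≤k = Q≤ᵏ⇒2 Q≤k
    ... | no  Q≰k = trans (P≤ᵏ-Q≰ᵏ P≤k Q≰k) (cong (λ s → s * (s - + 1)) (sgn-odd ∣ P ∣ᵥ odd))
    νL-F-condition (inj₂ (inj₂ (_ , _ , Q≤k))) = Q≤ᵏ⇒2 Q≤k

    νL-F-¬condition : ¬ F-condition k (E ∷ʳ i) E i → νL k (F (E ∷ʳ i)) ≡ + 0
    νL-F-¬condition ¬cond with ≤ᵏ? Q k | ≤ᵏ? P k
    ... | yes Q≤k | _       = ⊥-elim (¬cond condition)
      where
      condition : F-condition k (E ∷ʳ i) E i
      condition with ∣ i ∣ᵥ ℕₚ.≟ 1 | odd⊎even ∣ P ∣ᵥ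
      ... | yes unit | _         = inj₁ (subst (_≤ᵏ k) (trans (cong (P +ᵥ_) (leadCoord-Unit i unit)) (sym (ΣI-∷ʳ E i))) Q≤k)
      ... | no  ¬unit | inj₁ odd = inj₂ (inj₁ (odd , ≤ᵥ-≤ᵏ-trans P≤ᵥQ Q≤k))
      ... | no  ¬unit | inj₂ even =
        inj₂ (inj₂ (even , ℕₚ.≤∧≢⇒< (isZeroᵇ≡false⇒1≤∣∣ i i≢0) (¬unit ∘ sym) , Q≤k))
    ... | no  Q≰k | no  P≰k = P≰ᵏ⇒0 P≰k
    ... | no  Q≰k | yes P≤k with odd⊎even ∣ P ∣ᵥ
    ...   | inj₁ odd  = ⊥-elim (¬cond (inj₂ (inj₁ (odd , P≤k))))
    ...   | inj₂ even = trans (P≤ᵏ-Q≰ᵏ P≤k Q≰k) (cong (λ s → s * (s - + 1)) (sgn-even ∣ P ∣ᵥ even))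

  module _ {ℓ : ℕ} (k : Vec ℕ∞ ℓ) where

    νL-M-[] : νL k (M []) ≡ + 1
    νL-M-[] = begin
      νL k (M [])                        ≡⟨ trans (νL-M k []) (νM≡νʰ k []) ⟩
      sgnᵏ k zeroV * + 1 * + 1 + + 0     ≡⟨ trans (ℤₚ.+-identityʳ _) (trans (ℤₚ.*-identityʳ _) (ℤₚ.*-identityʳ _)) ⟩
      sgnᵏ k zeroV                       ≡⟨ sgnᵏ-zeroV ⟩
      + 1                                ∎
      where
      sgnᵏ-zeroV : sgnᵏ k zeroV ≡ + 1
      sgnᵏ-zeroV with leqᵇ zeroV k
      ... | true  = cong sgn (∣zeroV∣ {ℓ})
      ... | false = refl

    νL-F-good : (I : VC ℓ) → All NonZeroV I → F-good k I → νL k (F I) ≡ + 2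
    νL-F-good _ ≢0s (E , i , refl , coords , cond) =
      νL-F-condition k E i ≢0s (All.map (λ (j , v≡) → trans (cong ∣_∣ᵥ v≡) (∣coord∣ j)) coords) cond

    νL-F-¬good : (I : VC ℓ) → All NonZeroV I → I ≢ [] → ¬ F-good k I → νL k (F I) ≡ + 0
    νL-F-¬good I ≢0s I≢[] ¬good with initLast I
    ... | []       = ⊥-elim (I≢[] refl)
    ... | E ∷ʳ′ i with All.all? (λ v → ∣ v ∣ᵥ ℕₚ.≟ 1) E
    ...   | yes units = νL-F-¬condition k E i ≢0s units
                          (λ cond → ¬good (E , i , refl , All.map (Unit⇒IsCoord _) units , cond))
    ...   | no ¬units = trans (νL-F k (E ∷ʳ i)) (νʰF-nonunit-∷ʳ (sgnᵏ k) E i ≢0s ¬units)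

open import Data.Nat using (ℕ; _≤_; _<_; _+_)
open import Data.Integer using (+_; _*_)
open import Data.Product using (_×_; _,_; ∃-syntax)
open import Data.Sum using (_⊎_)
open import Data.List using ([]; _∷ʳ_; length)
open import Data.List.Relation.Unary.All using (All)
open import Data.Vec using (Vec)
open import Relation.Binary.PropositionalEquality using (_≡_; _≢_)
open import Relation.Nullary using (¬_)
open Lemmas using (νL-M-[]; νL-M-odd-last; νL-M-odd-init; νL-M-otherwise; νL-F-good; νL-F-¬good)

theorem6p2 : (ℓ : ℕ) → 1 ≤ ℓ → (k : Vec ℕ∞ ℓ) →
  -- values on the monomial basis
  (νL k (M []) ≡ + 1)
  × (∀ (J : VC ℓ) (i : Vec ℕ ℓ) → All NonZeroV (J ∷ʳ i) →
       ((Odd ∣ i ∣ᵥ × ΣI (J ∷ʳ i) ≤ᵏ k) →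
          νL k (M (J ∷ʳ i)) ≡ + 2 * sgn (length (J ∷ʳ i) + ∣ J ∷ʳ i ∣c))
     × ((Odd ∣ J ∣c × ΣI J ≤ᵏ k × ¬ (ΣI (J ∷ʳ i) ≤ᵏ k)) →
          νL k (M (J ∷ʳ i)) ≡ + 2 * sgn (length (J ∷ʳ i)))
     × (¬ (Odd ∣ i ∣ᵥ × ΣI (J ∷ʳ i) ≤ᵏ k) →
        ¬ (Odd ∣ J ∣c × ΣI J ≤ᵏ k × ¬ (ΣI (J ∷ʳ i) ≤ᵏ k)) →
          νL k (M (J ∷ʳ i)) ≡ + 0))
  -- values on the fundamental basis
  × (νL k (F []) ≡ + 1)
  × (∀ (I : VC ℓ) → All NonZeroV I → I ≢ [] →
       let good = ∃[ E ] ∃[ i ] (I ≡ E ∷ʳ i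
                    × All (λ v → ∃[ j ] v ≡ coord j) E
                    × (ΣI I ≤ᵏ k
                       ⊎ (Odd ∣ E ∣c × ΣI E ≤ᵏ k)
                       ⊎ (Even ∣ E ∣c × 1 < ∣ i ∣ᵥ × (ΣI E +ᵥ leadCoord i) ≤ᵏ k)))
       in (good → νL k (F I) ≡ + 2) × (¬ good → νL k (F I) ≡ + 0))
theorem6p2 ℓ _ k =
  νL-M-[] k ,
  (λ J i _ → νL-M-odd-last k J i , νL-M-odd-init k J i , νL-M-otherwise k J i) ,
  νL-M-[] k ,
  (λ I ≢0s I≢[] → νL-F-good k I ≢0s , νL-F-¬good k I ≢0s I≢[])
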